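{- Let $\eta,\mu>0$, let $n$ be sufficiently large, let $\mathcal{H}\in Forb(n,F_5,\eta,\mu)$ and let $U_1,U_2,U_3$ be an optimal partition of $\mathcal{H}$ that is $\mu$-lower dense. Let $x\in U_1$. Then each of the following holds: (i) $|L_{1,1}(x)|<2\mu n^2$; (ii) $|L_{1,2}(x)|<2\mu n^2$; (iii) $|L_{2,2}(x)|<2\mu n^2$; (iv) $|L_{1,3}(x)|<2\mu n^2$; (v) $|L_{3,3}(x)|<2\mu n^2$.
   Context: A $3$-graph on $[n]$ is a set of $3$-element subsets (edges) of $[n]$. Let $F_5$ be the $3$-graph with edges $\{1,2,3\},\{1,2,4\},\{3,4,5\}$; $Forb(n,F_5)$ is the set of labeled $3$-graphs on $[n]$ with no (not necessarily induced) copy of $F_5$. For a partition of the vertex set into three parts, an edge is crossing if it has exactly one vertex in each part, otherwise non-crossing. An optimal partition of $\mathcal{H}$ is a $3$-partition of its vertices minimizing the number of non-crossing edges; $D_{\mathcal{H}}$ is that minimum. $Forb(n,F_5,\eta)=\{\mathcal{H}\in Forb(n,F_5): D_{\mathcal{H}}\le\eta n^3\}$. A vertex partition $U_1,U_2,U_3$ of a $3$-graph $\mathcal{F}$ on $[n]$ is $\mu$-lower dense if: (i) for all $A_i\subset U_i$ ($i=1,2,3$) with $|A_i|\ge\mu n$, the number of edges $E$ with $|E\cap A_i|=1$ for all $i$ exceeds $|A_1||A_2||A_3|2^{ -3}$; (ii) for $\{i,j,\ell\}=\{1,2,3\}$, every $A_i\subset U_i$ with $|A_i|\ge\mu n$ and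 every set $G\subset U_j\times U_\ell$ with $|G|\ge\mu^2n^2$, the number of edges $E$ with $|E\cap A_i|=1$ and $E\setminus A_i\in G$ exceeds $|A_i||G|2^{ -3}$; (iii) for $\{i,j,\ell\}=\{1,2,3\}$, every $A_i\subset U_i$, $A_j\subset U_j$ with $|A_i|,|A_j|\ge\mu n$ and every matching $G$ on $U_\ell$ with $|G|\ge\mu n$, the number of pairs $\{C,D\}$ of edges with $C\setminus U_\ell=D\setminus U_\ell$, $|C\cap A_i|=|C\cap A_j|=1$ and $\{C\cap U_\ell,D\cap U_\ell\}\in G$ is at least $|A_i||A_j||G|/2^7$; (iv) $\big||U_i|-n/3\big|<\mu n$ for every $i$. $Forb(n,F_5,\eta,\mu)$ is the family of $\mathcal{H}\in Forb(n,F_5,\eta)$ that are $\mu$-lower dense (their optimal partitions are $\mu$-lower dense). For a vertex $x$ and $i\ne j$, $L_{i,j}(x)$ is the set of edges $\{x,u,v\}$ of $\mathcal{H}$ with $u\in U_i$, $v\in U_j$; $L_{i,i}(x)$ is the set of edges of $\mathcal{H}$ containing $x$ whose two other vertices lie in $U_i$.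
   Formalization: The parameters η and μ range over the positive rationals. -}

module Defs where

open import Data.Nat as ℕ using (ℕ; zero; suc; _+_; _*_; _^_)
open import Data.Bool using (Bool; true; false; _∧_; _∨_; not; if_then_else_)
open import Data.Fin using (Fin; zero; suc; _<?_; _≟_; #_)
open import Data.Integer using (+_)
open import Data.Rational as ℚ using (ℚ; _/_)
open import Data.Product using (Σ; _×_; ∃; ∃-syntax)
open import Relation.Binary.PropositionalEquality using (_≡_; _≢_)
open import Relation.Nullary.Negation using (¬_)
open import Relation.Nullary.Decidable using (⌊_⌋)

Σ[] : ∀ {n} → (Fin n → ℕ) → ℕ
Σ[] {zero}  f = 0
Σ[] {suc n} f = f zero + Σ[] (λ i → f (suc i))

[_] : Bool → ℕ
[ b ] = if b then 1 else 0

size : ∀ {n} → (Fin n → Bool) → ℕ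
size A = Σ[] (λ v → [ A v ])

_<ᵇ_ : ∀ {n} → Fin n → Fin n → Bool
a <ᵇ b = ⌊ a <? b ⌋

_==_ : ∀ {n} → Fin n → Fin n → Bool
a == b = ⌊ a ≟ b ⌋

count3 : ∀ {n} → (Fin n → Fin n → Fin n → Bool) → ℕ
count3 P = Σ[] λ a → Σ[] λ b → Σ[] λ c → [ (a <ᵇ b) ∧ (b <ᵇ c) ∧ P a b c ]

count2 : ∀ {n} → (Fin n → Fin n → Bool) → ℕ
count2 P = Σ[] λ a → Σ[] λ b → [ (a <ᵇ b) ∧ P a b ]

ℕ→ℚ : ℕ → ℚ
ℕ→ℚ k = (+ k) / 1

-- 3-graphs on [n] = Fin n : a set of 3-element subsets, encoded by its
-- (symmetric) indicator function, false on triples with repeated vertices.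

record ThreeGraph (n : ℕ) : Set where
  field
    edge    : Fin n → Fin n → Fin n → Bool
    sym₁₂   : ∀ a b c → edge a b c ≡ edge b a c
    sym₂₃   : ∀ a b c → edge a b c ≡ edge a c b
    nondeg  : ∀ a b c → edge a b c ≡ true → (a ≢ b) × (b ≢ c) × (a ≢ c)
open ThreeGraph public

-- F₅ = {123,124,345}; H contains a (not necessarily induced) copy
-- iff there is an injective map φ : [5] → [n] sending the edges to edges.
-- (vertices 1..5 are 0..4 in Fin 5)
F5-free : ∀ {n} → ThreeGraph n → Set
F5-free {n} H = ¬ (Σ (Fin 5 → Fin n) λ φ →
    (∀ i j → φ i ≡ φ j → i ≡ j) ×
    (edge H (φ (# 0)) (φ (# 1)) (φ (# 2)) ≡ true) ×
    (edge H (φ (# 0)) (φ (# 1)) (φ (# 3)) ≡ true) ×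
    (edge H (φ (# 2)) (φ (# 3)) (φ (# 4)) ≡ true))

-- 3-partitions: part v ∈ Fin 3 tells which of U₁,U₂,U₃ (= 0,1,2) contains v

Partition : ℕ → Set
Partition n = Fin n → Fin 3

allDistinct : Fin 3 → Fin 3 → Fin 3 → Bool
allDistinct i j k = not (i == j) ∧ not (j == k) ∧ not (i == k)

nonCrossing : ∀ {n} → ThreeGraph n → Partition n → ℕ
nonCrossing H P = count3 λ a b c → edge H a b c ∧ not (allDistinct (P a) (P b) (P c))

Optimal : ∀ {n} → ThreeGraph n → Partition n → Set
Optimal H P = ∀ Q → nonCrossing H P ℕ.≤ nonCrossing H Q

-- D_H ≤ t   (D_H is the number of non-crossing edges of an optimal partition)
D≤ : ∀ {n} → ThreeGraph n → ℚ → Set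
D≤ H t = ∃[ P ] (Optimal H P × ℚ._≤_ (ℕ→ℚ (nonCrossing H P)) t)

Distinct3 : Fin 3 → Fin 3 → Fin 3 → Set
Distinct3 i j l = (i ≢ j) × (j ≢ l) × (i ≢ l)

SubPart : ∀ {n} → Partition n → Fin 3 → (Fin n → Bool) → Set
SubPart P i A = ∀ v → A v ≡ true → P v ≡ i

meet : ∀ {n} → (Fin n → Bool) → Fin n → Fin n → Fin n → ℕ
meet A a b c = [ A a ] + [ A b ] + [ A c ]

meet1 : ∀ {n} → (Fin n → Bool) → Fin n → Fin n → Fin n → Bool
meet1 A a b c = ⌊ meet A a b c ℕ.≟ 1 ⌋

μn : ℚ → ℕ → ℚ
μn μ n = μ ℚ.* ℕ→ℚ n

LD-i : ∀ {n} → ThreeGraph n → Partition n → ℚ → Set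
LD-i {n} H P μ = ∀ (A₁ A₂ A₃ : Fin n → Bool) →
  SubPart P zero A₁ → SubPart P (suc zero) A₂ → SubPart P (suc (suc zero)) A₃ →
  μn μ n ℚ.≤ ℕ→ℚ (size A₁) → μn μ n ℚ.≤ ℕ→ℚ (size A₂) → μn μ n ℚ.≤ ℕ→ℚ (size A₃) →
  size A₁ * size A₂ * size A₃ ℕ.< 2 ^ 3 *
    count3 (λ a b c → edge H a b c ∧ meet1 A₁ a b c ∧ meet1 A₂ a b c ∧ meet1 A₃ a b c)

-- condition (ii). G ⊂ U_j × U_ℓ is a set of ordered pairs; a 2-set {u,v}
-- lies in G iff (u,v) ∈ G or (v,u) ∈ G.
-- E \ A for E = {a,b,c} with |E ∩ A| = 1, tested for membership in G:
restIn : ∀ {n} → (Fin n → Bool) → (Fin n → Fin n → Bool) → Fin n → Fin n → Fin n → Bool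
restIn A G a b c =
  if A a then (G b c ∨ G c b) else (if A b then (G a c ∨ G c a) else (G a b ∨ G b a))

LD-ii : ∀ {n} → ThreeGraph n → Partition n → ℚ → Set
LD-ii {n} H P μ = ∀ (i j l : Fin 3) → Distinct3 i j l →
  ∀ (A : Fin n → Bool) (G : Fin n → Fin n → Bool) →
  SubPart P i A → (∀ u v → G u v ≡ true → (P u ≡ j) × (P v ≡ l)) →
  μn μ n ℚ.≤ ℕ→ℚ (size A) →
  μ ℚ.* μ ℚ.* ℕ→ℚ n ℚ.* ℕ→ℚ n ℚ.≤ ℕ→ℚ (Σ[] λ u → Σ[] λ v → [ G u v ]) →
  size A * (Σ[] λ u → Σ[] λ v → [ G u v ]) ℕ.< 2 ^ 3 *
    count3 (λ a b c → edge H a b c ∧ meet1 A a b c ∧ restIn A G a b c)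

-- a matching on U_ℓ: symmetric irreflexive relation M (M u v = true iff
-- {u,v} ∈ G), pairs pairwise disjoint, all vertices in U_ℓ.
Matching : ∀ {n} → Partition n → Fin 3 → (Fin n → Fin n → Bool) → Set
Matching P l M =
  (∀ u v → M u v ≡ M v u) ×
  (∀ u → M u u ≡ false) ×
  (∀ u v w → M u v ≡ true → M u w ≡ true → v ≡ w) ×
  (∀ u v → M u v ≡ true → P u ≡ l)

-- A pair {C,D} of edges with C \ U_ℓ = D \ U_ℓ,
-- |C ∩ A_i| = |C ∩ A_j| = 1 and {C ∩ U_ℓ, D ∩ U_ℓ} ∈ G is exactly
-- C = {a,b,c}, D = {a,b,d} with a ∈ A_i, b ∈ A_j, {c,d} ∈ G; we count
-- such (a, b, {c,d}) (c < d to count unordered pairs {C,D} once).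
LD-iii : ∀ {n} → ThreeGraph n → Partition n → ℚ → Set
LD-iii {n} H P μ = ∀ (i j l : Fin 3) → Distinct3 i j l →
  ∀ (Aᵢ Aⱼ : Fin n → Bool) (M : Fin n → Fin n → Bool) →
  SubPart P i Aᵢ → SubPart P j Aⱼ → Matching P l M →
  μn μ n ℚ.≤ ℕ→ℚ (size Aᵢ) → μn μ n ℚ.≤ ℕ→ℚ (size Aⱼ) →
  μn μ n ℚ.≤ ℕ→ℚ (count2 M) →
  size Aᵢ * size Aⱼ * count2 M ℕ.≤ 2 ^ 7 *
    (Σ[] λ a → Σ[] λ b → count2 λ c d →
       Aᵢ a ∧ Aⱼ b ∧ M c d ∧ edge H a b c ∧ edge H a b d)

LD-iv : ∀ {n} → Partition n → ℚ → Set
LD-iv {n} P μ = ∀ (i : Fin 3) →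
  ℚ._<_ (ℚ.∣ ℕ→ℚ (size (λ v → P v == i)) ℚ.- ℕ→ℚ n ℚ.* (+ 1 / 3) ∣) (μn μ n)

LowerDense : ∀ {n} → ThreeGraph n → Partition n → ℚ → Set
LowerDense H P μ = LD-i H P μ × LD-ii H P μ × LD-iii H P μ × LD-iv P μ

InForb : ∀ {n} → ThreeGraph n → ℚ → ℚ → Set
InForb {n} H η μ =
  F5-free H ×
  D≤ H (η ℚ.* ℕ→ℚ n ℚ.* ℕ→ℚ n ℚ.* ℕ→ℚ n) ×
  (∀ P → Optimal H P → LowerDense H P μ)

Lsize : ∀ {n} → ThreeGraph n → Partition n → Fin n → Fin 3 → Fin 3 → ℕ
Lsize H P x i j = count2 λ u v →
  edge H x u v ∧ ((P u == i ∧ P v == j) ∨ (P u == j ∧ P v == i))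

-- For μ > 1/4 the trivial bound 2|L| ≤ n² suffices, and for 1/6 ≤ μ ≤ 1/4 so does
-- |L_{i,j}(x)| ≤ |U_i||U_j| < (1/3 + μ)²n², by condition (iv).  For μ ≤ 1/6 every part
-- has more than n/6 ≥ μn vertices and two F₅ configurations do the work:
-- • L_{l,l}(x): match the link of x inside U_l greedily.  If some matching M has μn
--   pairs, condition (iii) for the two other parts gives edges abc, abd with a ≠ x and
--   cd ∈ M, and abc, abd, cdx is an F₅; so the greedy procedure stops after fewer
--   than μn rounds, each discarding at most 2n pairs.
-- • L_{1,k}(x): moving x to another part shows |L_{1,k}(x)| ≤ |L_{k,k₂}(x)|.  The
--   vertices of U₁ with two link neighbours in U_k are then at least μn, and
--   condition (ii) gives an edge u w₁ w₂ with such a u and w₁w₂ ∈ L_{k,k₂}(x); with a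
--   second neighbour v of u, the edges w₁w₂x, w₁w₂u, xuv form an F₅.

module Submission where

open import Defs
open import Data.Nat as ℕ using (ℕ)
open import Data.Fin using (Fin; zero; suc)
open import Data.Rational as ℚ using (ℚ; 0ℚ; 1ℚ)
open import Relation.Binary.PropositionalEquality using (_≡_; _≢_)

module Combinatorics where
  open import Data.Nat as ℕ using (ℕ; zero; suc; _+_; _*_; _^_; _≤_; _<_; z≤n; s≤s)
  open import Data.Nat.Properties hiding (_≟_)
  open import Data.Bool using (Bool; true; false; _∧_; _∨_; not; if_then_else_)
  open import Data.Bool.Properties using (∧-comm; ∧-assoc; ∨-comm; ∨-idem; ∧-zeroʳ; ∧-identityʳ; ∧-distribˡ-∨)
  open import Data.Fin as Fin using (Fin; zero; suc; _≟_)
  import Data.Fin.Properties as FinP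
  open import Data.Empty using (⊥; ⊥-elim)
  open import Data.Sum using (_⊎_; inj₁; inj₂)
  open import Data.Product using (_×_; _,_; proj₁; proj₂; ∃-syntax)
  open import Relation.Binary using (tri<; tri≈; tri>)
  open import Relation.Binary.PropositionalEquality hiding ([_])
  open import Relation.Nullary using (Dec; yes; no; ¬_)
  open import Relation.Nullary.Decidable using (⌊_⌋)
  open import Data.Vec using ([]; _∷_; lookup)
  open import Data.Vec.Relation.Unary.AllPairs using ([]; _∷_)
  open import Data.Vec.Relation.Unary.All using ([]; _∷_)
  open import Data.Vec.Relation.Unary.Unique.Propositional using (Unique)
  open import Data.Vec.Relation.Unary.Unique.Propositional.Properties using (lookup-injective)
  open import Algebra.Properties.Semiring.Sum +-*-semiring
    using (sum; ∑-distrib-+; ∑-comm; *-distribˡ-sum)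

  -- Σ[] of Defs is the library's semiring sum over ℕ; the bridge lets us
  -- reuse the library's distributivity and interchange laws.
  Σ≡sum : ∀ {n} (f : Fin n → ℕ) → Σ[] f ≡ sum f
  Σ≡sum {zero}  f = refl
  Σ≡sum {suc n} f = cong (f zero +_) (Σ≡sum (λ i → f (suc i)))

  Σ-cong : ∀ {n} {f g : Fin n → ℕ} → (∀ i → f i ≡ g i) → Σ[] f ≡ Σ[] g
  Σ-cong {zero}  e = refl
  Σ-cong {suc n} e = cong₂ _+_ (e zero) (Σ-cong (λ i → e (suc i)))

  Σ-mono : ∀ {n} {f g : Fin n → ℕ} → (∀ i → f i ≤ g i) → Σ[] f ≤ Σ[] g
  Σ-mono {zero}  e = z≤n
  Σ-mono {suc n} e = +-mono-≤ (e zero) (Σ-mono (λ i → e (suc i)))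

  Σ-+ : ∀ {n} (f g : Fin n → ℕ) → Σ[] (λ i → f i + g i) ≡ Σ[] f + Σ[] g
  Σ-+ f g = begin
    Σ[] (λ i → f i + g i)  ≡⟨ Σ≡sum (λ i → f i + g i) ⟩
    sum (λ i → f i + g i)  ≡⟨ ∑-distrib-+ f g ⟩
    sum f + sum g          ≡⟨ sym (cong₂ _+_ (Σ≡sum f) (Σ≡sum g)) ⟩
    Σ[] f + Σ[] g          ∎
    where open ≡-Reasoning

  Σ-*ˡ : ∀ {n} k (f : Fin n → ℕ) → Σ[] (λ i → k * f i) ≡ k * Σ[] f
  Σ-*ˡ k f = trans (Σ≡sum (λ i → k * f i)) (sym (trans (cong (k *_) (Σ≡sum f)) (*-distribˡ-sum k f)))

  Σ-*ʳ : ∀ {n} k (f : Fin n → ℕ) → Σ[] (λ i → f i * k) ≡ Σ[] f * k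
  Σ-*ʳ k f = trans (Σ-cong (λ i → *-comm (f i) k)) (trans (Σ-*ˡ k f) (*-comm k _))

  Σ-const : ∀ {n} k → Σ[] {n} (λ _ → k) ≡ n * k
  Σ-const {zero}  k = refl
  Σ-const {suc n} k = cong (k +_) (Σ-const {n} k)

  Σ-swap : ∀ {m n} (f : Fin m → Fin n → ℕ) →
           Σ[] (λ i → Σ[] (f i)) ≡ Σ[] (λ j → Σ[] (λ i → f i j))
  Σ-swap f = begin
    Σ[] (λ i → Σ[] (f i))            ≡⟨ trans (Σ-cong (λ i → Σ≡sum (f i))) (Σ≡sum (λ i → sum (f i))) ⟩
    sum (λ i → sum (f i))            ≡⟨ ∑-comm f ⟩
    sum (λ j → sum (λ i → f i j))    ≡⟨ sym (trans (Σ-cong (λ j → Σ≡sum (λ i → f i j))) (Σ≡sum (λ j → sum (λ i → f i j)))) ⟩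
    Σ[] (λ j → Σ[] (λ i → f i j))    ∎
    where open ≡-Reasoning

  Σ-zero : ∀ {n} {f : Fin n → ℕ} → (∀ i → f i ≡ 0) → Σ[] f ≡ 0
  Σ-zero {n} e = trans (Σ-cong e) (trans (Σ-const {n} 0) (*-zeroʳ n))

  Σ-witness : ∀ {n} (f : Fin n → ℕ) → 0 < Σ[] f → ∃[ i ] 0 < f i
  Σ-witness {suc n} f p with f zero in fz
  ... | suc _ = zero , subst (0 <_) (sym fz) (s≤s z≤n)
  ... | zero with Σ-witness (λ i → f (suc i)) p
  ...   | i , q = suc i , q

  Σ-witness-≢ : ∀ {n} (f : Fin n → ℕ) (x : Fin n) → f x < Σ[] f → ∃[ i ] (i ≢ x × 0 < f i)
  Σ-witness-≢ {suc n} f zero p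
    with Σ-witness (λ i → f (suc i)) (+-cancelˡ-< (f zero) 0 _ (subst (_< Σ[] f) (sym (+-identityʳ (f zero))) p))
  ... | i , q = suc i , (λ ()) , q
  Σ-witness-≢ {suc n} f (suc x) p with f zero in fz
  ... | suc _ = zero , (λ ()) , subst (0 <_) (sym fz) (s≤s z≤n)
  ... | zero with Σ-witness-≢ (λ i → f (suc i)) x p
  ...   | i , i≢x , q = suc i , (λ e → i≢x (FinP.suc-injective e)) , q

  []≤1 : ∀ b → [ b ] ≤ 1
  []≤1 true  = s≤s z≤n
  []≤1 false = z≤n

  []-true : ∀ b → 0 < [ b ] → b ≡ true
  []-true true _ = refl

  [∧] : ∀ b c → [ b ∧ c ] ≡ [ b ] * [ c ]
  [∧] true  c = sym (+-identityʳ [ c ])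
  [∧] false c = refl

  [∨]≤ : ∀ b c → [ b ∨ c ] ≤ [ b ] + [ c ]
  [∨]≤ true  c = s≤s z≤n
  [∨]≤ false c = ≤-refl

  [∨]-disjoint : ∀ b c → (b ≡ true → c ≡ true → ⊥) → [ b ∨ c ] ≡ [ b ] + [ c ]
  [∨]-disjoint true  true  d = ⊥-elim (d refl refl)
  [∨]-disjoint true  false d = refl
  [∨]-disjoint false c     d = refl

  []-split : ∀ b c → [ b ] ≡ [ b ∧ not c ] + [ b ∧ c ]
  []-split true  true  = refl
  []-split true  false = refl
  []-split false c     = refl

  [∧]≤ʳ : ∀ b c → [ b ∧ c ] ≤ [ c ]
  [∧]≤ʳ true  c = ≤-refl
  [∧]≤ʳ false c = z≤n

  [∧∨]-disjoint : ∀ a b c → (a ≡ true → b ≡ true → c ≡ true → ⊥) → [ a ∧ (b ∨ c) ] ≡ [ a ∧ b ] + [ a ∧ c ]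
  [∧∨]-disjoint true  b c d = [∨]-disjoint b c (d refl)
  [∧∨]-disjoint false b c d = refl

  ∧-elim : ∀ {b c} → b ∧ c ≡ true → (b ≡ true) × (c ≡ true)
  ∧-elim {true} e = refl , e

  ∨-elim : ∀ {b c} → b ∨ c ≡ true → (b ≡ true) ⊎ (c ≡ true)
  ∨-elim {true}  _ = inj₁ refl
  ∨-elim {false} e = inj₂ e

  not-true : ∀ {b} → not b ≡ true → b ≡ false
  not-true {false} _ = refl

  ∧-false : ∀ b {c} → (b ≡ true → c ≡ false) → b ∧ c ≡ false
  ∧-false true  h = h refl
  ∧-false false h = refl

  isYes-true : ∀ {A : Set} (d : Dec A) → A → ⌊ d ⌋ ≡ true
  isYes-true (yes _) _ = refl
  isYes-true (no ¬a) a = ⊥-elim (¬a a)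

  isYes-false : ∀ {A : Set} (d : Dec A) → ¬ A → ⌊ d ⌋ ≡ false
  isYes-false (yes a) ¬a = ⊥-elim (¬a a)
  isYes-false (no _)  _  = refl

  isYes-sound : ∀ {A : Set} (d : Dec A) → ⌊ d ⌋ ≡ true → A
  isYes-sound (yes a) _ = a

  ==-sound : ∀ {n} (a b : Fin n) → (a == b) ≡ true → a ≡ b
  ==-sound a b = isYes-sound (a ≟ b)

  ==-refl : ∀ {n} (a : Fin n) → (a == a) ≡ true
  ==-refl a = isYes-true (a ≟ a) refl

  ==-false : ∀ {n} (a b : Fin n) → a ≢ b → (a == b) ≡ false
  ==-false a b = isYes-false (a ≟ b)

  ==-sym : ∀ {n} (a b : Fin n) → (a == b) ≡ (b == a)
  ==-sym a b with a ≟ b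
  ... | yes refl = sym (==-refl a)
  ... | no a≢b   = sym (==-false b a (λ e → a≢b (sym e)))

  <ᵇ-irrefl : ∀ {n} (a : Fin n) → (a <ᵇ a) ≡ false
  <ᵇ-irrefl a = isYes-false (a Fin.<? a) (FinP.<-irrefl refl)

  <ᵇ-sound : ∀ {n} (a b : Fin n) → (a <ᵇ b) ≡ true → a ≢ b
  <ᵇ-sound a b e refl = subst (λ c → c ≡ true → ⊥) (sym (<ᵇ-irrefl a)) (λ ()) e

  data Order {n} (a b : Fin n) : Set where
    less    : (a <ᵇ b) ≡ true  → (b <ᵇ a) ≡ false → a Fin.< b → Order a b
    same    : a ≡ b → Order a b
    greater : (a <ᵇ b) ≡ false → (b <ᵇ a) ≡ true  → b Fin.< a → Order a b

  compare : ∀ {n} (a b : Fin n) → Order a b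
  compare a b with FinP.<-cmp a b
  ... | tri< a<b _ b≮a = less (isYes-true (a Fin.<? b) a<b) (isYes-false (b Fin.<? a) b≮a) a<b
  ... | tri≈ _ a≡b _   = same a≡b
  ... | tri> a≮b _ b<a = greater (isYes-false (a Fin.<? b) a≮b) (isYes-true (b Fin.<? a) b<a) b<a

  Σ-point : ∀ {n} (x : Fin n) (f : Fin n → ℕ) → Σ[] (λ i → [ i == x ] * f i) ≡ f x
  Σ-point {suc n} zero f = trans (cong (λ t → f zero + 0 + t) (Σ-zero {n} (λ i → refl)))
                                 (trans (+-identityʳ _) (+-identityʳ _))
  Σ-point {suc n} (suc x) f = trans (Σ-cong (λ i → cong (λ b → [ b ] * f (suc i)) (==-suc i x)))
                                    (Σ-point x (λ i → f (suc i)))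
    where
    ==-suc : ∀ {m} (a b : Fin m) → (suc a == suc b) ≡ (a == b)
    ==-suc a b with a ≟ b
    ... | yes _ = refl
    ... | no _  = refl

  size≤ : ∀ {n} (A : Fin n → Bool) → size A ≤ n
  size≤ {n} A = ≤-trans (Σ-mono (λ v → []≤1 (A v))) (≤-reflexive (trans (Σ-const {n} 1) (*-identityʳ n)))

  ΣΣ : ∀ {n} → (Fin n → Fin n → ℕ) → ℕ
  ΣΣ f = Σ[] λ a → Σ[] λ b → f a b

  ΣΣ-cong : ∀ {n} {f g : Fin n → Fin n → ℕ} → (∀ a b → f a b ≡ g a b) → ΣΣ f ≡ ΣΣ g
  ΣΣ-cong e = Σ-cong (λ a → Σ-cong (e a))

  ΣΣ-mono : ∀ {n} {f g : Fin n → Fin n → ℕ} → (∀ a b → f a b ≤ g a b) → ΣΣ f ≤ ΣΣ g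
  ΣΣ-mono e = Σ-mono (λ a → Σ-mono (e a))

  ΣΣ-+ : ∀ {n} (f g : Fin n → Fin n → ℕ) → ΣΣ (λ a b → f a b + g a b) ≡ ΣΣ f + ΣΣ g
  ΣΣ-+ f g = trans (Σ-cong (λ a → Σ-+ (f a) (g a))) (Σ-+ (λ a → Σ[] (f a)) (λ a → Σ[] (g a)))

  Σ3 : ∀ {n} → (Fin n → Fin n → Fin n → ℕ) → ℕ
  Σ3 f = Σ[] λ a → ΣΣ (f a)

  Σ3-cong : ∀ {n} {f g : Fin n → Fin n → Fin n → ℕ} → (∀ a b c → f a b c ≡ g a b c) → Σ3 f ≡ Σ3 g
  Σ3-cong e = Σ-cong (λ a → ΣΣ-cong (e a))

  Σ3-+ : ∀ {n} (f g : Fin n → Fin n → Fin n → ℕ) → Σ3 (λ a b c → f a b c + g a b c) ≡ Σ3 f + Σ3 g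
  Σ3-+ f g = trans (Σ-cong (λ a → ΣΣ-+ (f a) (g a))) (Σ-+ (λ a → ΣΣ (f a)) (λ a → ΣΣ (g a)))

  ordered-pair : ∀ {n} (a b : Fin n) (w : Bool) → (a ≡ b → w ≡ false) →
                 [ (a <ᵇ b) ∧ w ] + [ (b <ᵇ a) ∧ w ] ≡ [ w ]
  ordered-pair a b w d with compare a b
  ... | less    ab ba _ rewrite ab | ba = +-identityʳ [ w ]
  ... | same    refl    rewrite <ᵇ-irrefl a | d refl = refl
  ... | greater ab ba _ rewrite ab | ba = refl

  count2-flip : ∀ {n} (G : Fin n → Fin n → Bool) → (∀ a → G a a ≡ false) →
                count2 G + count2 (λ a b → G b a) ≡ ΣΣ (λ a b → [ G a b ])
  count2-flip G irr = begin
    count2 G + count2 (λ a b → G b a)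
      ≡⟨ cong (count2 G +_) (Σ-swap (λ a b → [ (a <ᵇ b) ∧ G b a ])) ⟩
    ΣΣ (λ a b → [ (a <ᵇ b) ∧ G a b ]) + ΣΣ (λ a b → [ (b <ᵇ a) ∧ G a b ])
      ≡⟨ ΣΣ-+ (λ a b → [ (a <ᵇ b) ∧ G a b ]) (λ a b → [ (b <ᵇ a) ∧ G a b ]) ⟨
    ΣΣ (λ a b → [ (a <ᵇ b) ∧ G a b ] + [ (b <ᵇ a) ∧ G a b ])
      ≡⟨ ΣΣ-cong (λ a b → ordered-pair a b (G a b) (λ { refl → irr a })) ⟩
    ΣΣ (λ a b → [ G a b ]) ∎
    where open ≡-Reasoning

  count2-symmetric : ∀ {n} (G : Fin n → Fin n → Bool) → (∀ a → G a a ≡ false) →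
                     (∀ a b → G a b ≡ G b a) → count2 G + count2 G ≡ ΣΣ (λ a b → [ G a b ])
  count2-symmetric G irr sym-G =
    trans (cong (count2 G +_) (ΣΣ-cong (λ a b → cong (λ t → [ (a <ᵇ b) ∧ t ]) (sym-G a b))))
          (count2-flip G irr)

  ΣΣ-product : ∀ {n} (p q : Fin n → Bool) → ΣΣ (λ a b → [ p a ∧ q b ]) ≡ size p * size q
  ΣΣ-product p q = trans (ΣΣ-cong (λ a b → [∧] (p a) (q b)))
    (trans (Σ-cong (λ a → Σ-*ˡ [ p a ] (λ b → [ q b ]))) (Σ-*ʳ (size q) (λ a → [ p a ])))

  ΣΣ-square : ∀ {n} (f : Fin n → Fin n → Bool) → ΣΣ (λ a b → [ f a b ]) ≤ n * n
  ΣΣ-square {n} f = ≤-trans (ΣΣ-mono {g = λ _ _ → 1} (λ a b → []≤1 (f a b)))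
    (≤-reflexive (trans (Σ-cong {n} (λ a → Σ-const {n} 1)) (trans (Σ-const {n} (n * 1)) (cong (n *_) (*-identityʳ n)))))

  count2-witness : ∀ {n} (G : Fin n → Fin n → Bool) → 0 < count2 G →
                   ∃[ u ] ∃[ v ] ((u <ᵇ v) ≡ true × G u v ≡ true)
  count2-witness G p with Σ-witness _ p
  ... | u , q with Σ-witness (λ b → [ (u <ᵇ b) ∧ G u b ]) q
  ...   | v , r = u , v , ∧-elim ([]-true _ r)

  touches : ∀ {n} → Fin n → Fin n → Fin n → Bool
  touches w a b = (a == w) ∨ (b == w)

  touches-point : ∀ {n} (w a b : Fin n) →
    [ (a <ᵇ b) ∧ touches w a b ] ≤ [ a == w ] * [ w <ᵇ b ] + [ b == w ] * [ a <ᵇ w ]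
  touches-point w a b with a ≟ w | b ≟ w
  ... | yes refl | _ = ≤-trans (≤-reflexive (trans (cong [_] (∧-identityʳ (a <ᵇ b))) (sym (+-identityʳ [ a <ᵇ b ]))))
                               (m≤m+n _ _)
  ... | no _ | yes refl = ≤-reflexive (trans (cong [_] (∧-identityʳ (a <ᵇ b))) (sym (+-identityʳ [ a <ᵇ b ])))
  ... | no _ | no _ = ≤-trans (≤-reflexive (cong [_] (∧-zeroʳ (a <ᵇ b)))) z≤n

  count2-touches : ∀ {n} (w : Fin n) → count2 (touches w) ≤ n
  count2-touches {n} w = begin
    count2 (touches w)
      ≤⟨ ΣΣ-mono (touches-point w) ⟩
    ΣΣ (λ a b → [ a == w ] * [ w <ᵇ b ] + [ b == w ] * [ a <ᵇ w ])
      ≡⟨ ΣΣ-+ (λ a b → [ a == w ] * [ w <ᵇ b ]) (λ a b → [ b == w ] * [ a <ᵇ w ]) ⟩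
    ΣΣ (λ a b → [ a == w ] * [ w <ᵇ b ]) + ΣΣ (λ a b → [ b == w ] * [ a <ᵇ w ])
      ≡⟨ cong₂ _+_ (trans (Σ-cong (λ a → Σ-*ˡ [ a == w ] (λ b → [ w <ᵇ b ])))
                          (Σ-point w (λ _ → Σ[] (λ b → [ w <ᵇ b ]))))
                   (Σ-cong (λ a → Σ-point w (λ _ → [ a <ᵇ w ]))) ⟩
    Σ[] (λ c → [ w <ᵇ c ]) + Σ[] (λ c → [ c <ᵇ w ])
      ≡⟨ Σ-+ (λ c → [ w <ᵇ c ]) (λ c → [ c <ᵇ w ]) ⟨
    Σ[] (λ c → [ w <ᵇ c ] + [ c <ᵇ w ])
      ≤⟨ Σ-mono (λ c → at-most-one c) ⟩
    Σ[] {n} (λ _ → 1)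
      ≡⟨ trans (Σ-const {n} 1) (*-identityʳ n) ⟩
    n ∎
    where
    open ≤-Reasoning
    at-most-one : ∀ c → [ w <ᵇ c ] + [ c <ᵇ w ] ≤ 1
    at-most-one c with compare w c
    ... | less    wc cw _ rewrite wc | cw = ≤-refl
    ... | same    refl    rewrite <ᵇ-irrefl w = z≤n
    ... | greater wc cw _ rewrite wc | cw = ≤-refl

  U : ∀ {n} → Partition n → Fin 3 → Fin n → Bool
  U P i v = P v == i

  U-sub : ∀ {n} (P : Partition n) i → SubPart P i (U P i)
  U-sub P i v = ==-sound (P v) i

  part-≢ : ∀ {n} (P : Partition n) {a b : Fin n} {i j : Fin 3} → P a ≡ i → P b ≡ j → i ≢ j → a ≢ b
  part-≢ P pa pb i≢j refl = i≢j (trans (sym pa) pb)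

  module Link {n : ℕ} (H : ThreeGraph n) (P : Partition n) (x : Fin n) where

    link : Fin 3 → Fin 3 → Fin n → Fin n → Bool
    link i j u v = edge H x u v ∧ ((P u == i ∧ P v == j) ∨ (P u == j ∧ P v == i))

    link→ : Fin 3 → Fin 3 → Fin n → Fin n → Bool
    link→ i j u v = edge H x u v ∧ (P u == i ∧ P v == j)

    link→-parts : ∀ i j u v → link→ i j u v ≡ true → (P u ≡ i) × (P v ≡ j)
    link→-parts i j u v e with ∧-elim {P u == i} (proj₂ (∧-elim {edge H x u v} e))
    ... | pu , pv = ==-sound (P u) i pu , ==-sound (P v) j pv

    edge-x-irrefl : ∀ u → edge H x u u ≡ false
    edge-x-irrefl u with edge H x u u in e
    ... | true  = ⊥-elim (proj₁ (proj₂ (nondeg H x u u e)) refl)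
    ... | false = refl

    link-sym : ∀ i j u v → link i j u v ≡ link i j v u
    link-sym i j u v = cong₂ _∧_ (sym₂₃ H x u v) (begin
      (P u == i ∧ P v == j) ∨ (P u == j ∧ P v == i) ≡⟨ ∨-comm (P u == i ∧ P v == j) _ ⟩
      (P u == j ∧ P v == i) ∨ (P u == i ∧ P v == j) ≡⟨ cong₂ _∨_ (∧-comm (P u == j) _) (∧-comm (P u == i) _) ⟩
      (P v == i ∧ P u == j) ∨ (P v == j ∧ P u == i) ∎)
      where open ≡-Reasoning

    Lsize-double : ∀ i j → Lsize H P x i j + Lsize H P x i j ≡ ΣΣ (λ u v → [ link i j u v ])
    Lsize-double i j = count2-symmetric (link i j) (λ u → cong (_∧ _) (edge-x-irrefl u)) (link-sym i j)

    Lsize≤square : ∀ i j → Lsize H P x i j + Lsize H P x i j ≤ n * n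
    Lsize≤square i j = ≤-trans (≤-reflexive (Lsize-double i j)) (ΣΣ-square (link i j))

    Lsize≤product : ∀ i j → Lsize H P x i j ≤ size (U P i) * size (U P j)
    Lsize≤product i j = *-cancelˡ-≤ 2 (begin
      2 * Lsize H P x i j
        ≡⟨ cong (Lsize H P x i j +_) (+-identityʳ _) ⟩
      Lsize H P x i j + Lsize H P x i j
        ≡⟨ Lsize-double i j ⟩
      ΣΣ (λ u v → [ link i j u v ])
        ≤⟨ ΣΣ-mono (λ u v → ≤-trans ([∧]≤ʳ (edge H x u v) _) ([∨]≤ (P u == i ∧ P v == j) _)) ⟩
      ΣΣ (λ u v → [ P u == i ∧ P v == j ] + [ P u == j ∧ P v == i ])
        ≡⟨ ΣΣ-+ (λ u v → [ P u == i ∧ P v == j ]) (λ u v → [ P u == j ∧ P v == i ]) ⟩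
      ΣΣ (λ u v → [ P u == i ∧ P v == j ]) + ΣΣ (λ u v → [ P u == j ∧ P v == i ])
        ≡⟨ cong₂ _+_ (ΣΣ-product (U P i) (U P j)) (ΣΣ-product (U P j) (U P i)) ⟩
      size (U P i) * size (U P j) + size (U P j) * size (U P i)
        ≡⟨ cong (size (U P i) * size (U P j) +_) (trans (*-comm (size (U P j)) _) (sym (+-identityʳ _))) ⟩
      2 * (size (U P i) * size (U P j)) ∎)
      where open ≤-Reasoning

    -- for i ≢ j each unordered link pair has exactly one order with u ∈ U_i
    Lsize-ordered : ∀ i j → i ≢ j → Lsize H P x i j ≡ ΣΣ (λ u v → [ link→ i j u v ])
    Lsize-ordered i j i≢j = begin
      Lsize H P x i j
        ≡⟨ ΣΣ-cong split ⟩
      ΣΣ (λ u v → [ (u <ᵇ v) ∧ link→ i j u v ] + [ (u <ᵇ v) ∧ link→ i j v u ])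
        ≡⟨ ΣΣ-+ (λ u v → [ (u <ᵇ v) ∧ link→ i j u v ]) (λ u v → [ (u <ᵇ v) ∧ link→ i j v u ]) ⟩
      count2 (link→ i j) + count2 (λ u v → link→ i j v u)
        ≡⟨ count2-flip (link→ i j) (λ u → cong (_∧ _) (edge-x-irrefl u)) ⟩
      ΣΣ (λ u v → [ link→ i j u v ]) ∎
      where
      open ≡-Reasoning
      flipped : ∀ u v → edge H x u v ∧ (P u == j ∧ P v == i) ≡ link→ i j v u
      flipped u v = cong₂ _∧_ (sym₂₃ H x u v) (∧-comm (P u == j) (P v == i))
      split : ∀ u v → [ (u <ᵇ v) ∧ link i j u v ] ≡ [ (u <ᵇ v) ∧ link→ i j u v ] + [ (u <ᵇ v) ∧ link→ i j v u ]
      split u v = begin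
        [ (u <ᵇ v) ∧ link i j u v ]
          ≡⟨ cong (λ t → [ (u <ᵇ v) ∧ t ]) (∧-distribˡ-∨ (edge H x u v) _ _) ⟩
        [ (u <ᵇ v) ∧ (link→ i j u v ∨ (edge H x u v ∧ (P u == j ∧ P v == i))) ]
          ≡⟨ [∧∨]-disjoint (u <ᵇ v) (link→ i j u v) (edge H x u v ∧ (P u == j ∧ P v == i)) (λ _ p q →
               i≢j (trans (sym (proj₁ (link→-parts i j u v p))) (proj₁ (link→-parts j i u v q)))) ⟩
        [ (u <ᵇ v) ∧ link→ i j u v ] + [ (u <ᵇ v) ∧ (edge H x u v ∧ (P u == j ∧ P v == i)) ]
          ≡⟨ cong (λ t → [ (u <ᵇ v) ∧ link→ i j u v ] + [ (u <ᵇ v) ∧ t ]) (flipped u v) ⟩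
        [ (u <ᵇ v) ∧ link→ i j u v ] + [ (u <ᵇ v) ∧ link→ i j v u ] ∎

    Lsize-comm : ∀ i j → Lsize H P x i j ≡ Lsize H P x j i
    Lsize-comm i j = ΣΣ-cong (λ u v → cong (λ t → [ (u <ᵇ v) ∧ (edge H x u v ∧ t) ]) (∨-comm (P u == i ∧ P v == j) _))

  touches3 : ∀ {n} → Fin n → Fin n → Fin n → Fin n → Bool
  touches3 x a b c = (a == x) ∨ ((b == x) ∨ (c == x))

  Symmetric3 : ∀ {n} → (Fin n → Fin n → Fin n → Bool) → Set
  Symmetric3 Φ = (∀ a b c → Φ a b c ≡ Φ b a c) × (∀ a b c → Φ a b c ≡ Φ a c b)

  increasing-≢ : ∀ {n} (a b c : Fin n) → (a <ᵇ b) ≡ true → (b <ᵇ c) ≡ true →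
                 (a ≢ b) × (b ≢ c) × (a ≢ c)
  increasing-≢ a b c ab bc = <ᵇ-sound a b ab , <ᵇ-sound b c bc ,
    λ { refl → <-asym (isYes-sound (a Fin.<? b) ab) (isYes-sound (b Fin.<? a) bc) }

  [∧]ᶜ : ∀ t p → [ t ∧ p ] ≡ [ p ] * [ t ]
  [∧]ᶜ t p = trans ([∧] t p) (*-comm [ t ] [ p ])

  increasing-touches : ∀ {n} (x a b c : Fin n) (φ : Bool) → let t = (a <ᵇ b) ∧ ((b <ᵇ c) ∧ φ) in
    [ t ∧ touches3 x a b c ] ≡ [ a == x ] * [ t ] + ([ b == x ] * [ t ] + [ c == x ] * [ t ])
  increasing-touches x a b c φ = begin
    [ t ∧ touches3 x a b c ]
      ≡⟨ [∧∨]-disjoint t (a == x) _ first-alone ⟩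
    [ t ∧ (a == x) ] + [ t ∧ ((b == x) ∨ (c == x)) ]
      ≡⟨ cong ([ t ∧ (a == x) ] +_) ([∧∨]-disjoint t (b == x) (c == x) (λ tt bx cx →
           proj₁ (proj₂ (distinct tt)) (trans (==-sound b x bx) (sym (==-sound c x cx))))) ⟩
    [ t ∧ (a == x) ] + ([ t ∧ (b == x) ] + [ t ∧ (c == x) ])
      ≡⟨ cong₂ _+_ ([∧]ᶜ t (a == x)) (cong₂ _+_ ([∧]ᶜ t (b == x)) ([∧]ᶜ t (c == x))) ⟩
    [ a == x ] * [ t ] + ([ b == x ] * [ t ] + [ c == x ] * [ t ]) ∎
    where
    open ≡-Reasoning
    t = (a <ᵇ b) ∧ ((b <ᵇ c) ∧ φ)
    distinct : t ≡ true → (a ≢ b) × (b ≢ c) × (a ≢ c)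
    distinct tt with ∧-elim {a <ᵇ b} tt
    ... | ab , rest = increasing-≢ a b c ab (proj₁ (∧-elim {b <ᵇ c} rest))
    first-alone : t ≡ true → (a == x) ≡ true → ((b == x) ∨ (c == x)) ≡ true → ⊥
    first-alone tt ax bcx with ∨-elim {b == x} bcx
    ... | inj₁ bx = proj₁ (distinct tt) (trans (==-sound a x ax) (sym (==-sound b x bx)))
    ... | inj₂ cx = proj₂ (proj₂ (distinct tt)) (trans (==-sound a x ax) (sym (==-sound c x cx)))

  sorted-positions : ∀ {n} (x u v : Fin n) (w : Bool) → (w ≡ true → (x ≢ u) × (x ≢ v)) →
    [ (u <ᵇ v) ∧ w ] ≡ [ (x <ᵇ u) ∧ ((u <ᵇ v) ∧ w) ] + ([ (u <ᵇ x) ∧ ((x <ᵇ v) ∧ w) ] + [ (u <ᵇ v) ∧ ((v <ᵇ x) ∧ w) ])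
  sorted-positions x u v false _
    rewrite ∧-zeroʳ (u <ᵇ v) | ∧-zeroʳ (x <ᵇ v) | ∧-zeroʳ (v <ᵇ x)
          | ∧-zeroʳ (x <ᵇ u) | ∧-zeroʳ (u <ᵇ x) | ∧-zeroʳ (u <ᵇ v) = refl
  sorted-positions x u v true h with compare x u | compare x v | compare u v
  ... | same e | _ | _ = ⊥-elim (proj₁ (h refl) e)
  ... | _ | same e | _ = ⊥-elim (proj₂ (h refl) e)
  ... | less a1 a2 _ | less _ b2 _ | less c1 _ _ rewrite a1 | a2 | b2 | c1 = refl
  ... | less a1 a2 _ | less b1 b2 _ | same refl rewrite a1 | a2 | b1 | b2 | <ᵇ-irrefl u = refl
  ... | less a1 a2 _ | less _ b2 _ | greater c1 _ _ rewrite a1 | a2 | b2 | c1 = refl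
  ... | less _ _ p | greater _ _ q | less _ _ r = ⊥-elim (<-asym (<-trans p r) q)
  ... | less a1 a2 _ | greater b1 b2 _ | same refl rewrite a1 | a2 | b1 | b2 | <ᵇ-irrefl u = refl
  ... | less a1 a2 _ | greater _ b2 _ | greater c1 _ _ rewrite a1 | a2 | b2 | c1 = refl
  ... | greater a1 a2 _ | less b1 b2 _ | less c1 _ _ rewrite a1 | a2 | b1 | b2 | c1 = refl
  ... | greater a1 a2 _ | less b1 b2 _ | same refl rewrite a1 | a2 | b1 | b2 | <ᵇ-irrefl u = refl
  ... | greater _ _ p | less _ _ q | greater _ _ r = ⊥-elim (<-asym (<-trans p q) r)
  ... | greater a1 a2 _ | greater b1 b2 _ | less c1 _ _ rewrite a1 | a2 | b1 | b2 | c1 = refl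
  ... | greater a1 a2 _ | greater b1 b2 _ | same refl rewrite a1 | a2 | b1 | b2 | <ᵇ-irrefl u = refl
  ... | greater a1 a2 _ | greater b1 b2 _ | greater c1 _ _ rewrite a1 | a2 | b1 | b2 | c1 = refl

  count3-at : ∀ {n} (Φ : Fin n → Fin n → Fin n → Bool) (x : Fin n) → Symmetric3 Φ →
              (∀ u v → Φ x u v ≡ true → (x ≢ u) × (x ≢ v)) →
              count3 Φ ≡ count3 (λ a b c → Φ a b c ∧ not (touches3 x a b c)) + count2 (Φ x)
  count3-at {n} Φ x (s₁₂ , s₂₃) avoid-x = begin
    count3 Φ
      ≡⟨ Σ3-cong (λ a b c → []-split (T a b c) (touches3 x a b c)) ⟩
    Σ3 (λ a b c → [ T a b c ∧ not (touches3 x a b c) ] + [ T a b c ∧ touches3 x a b c ])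
      ≡⟨ Σ3-+ (λ a b c → [ T a b c ∧ not (touches3 x a b c) ]) (λ a b c → [ T a b c ∧ touches3 x a b c ]) ⟩
    Σ3 (λ a b c → [ T a b c ∧ not (touches3 x a b c) ]) + Σ3 (λ a b c → [ T a b c ∧ touches3 x a b c ])
      ≡⟨ cong₂ _+_ (Σ3-cong (λ a b c → cong [_] (reassociate a b c))) through-x ⟩
    count3 (λ a b c → Φ a b c ∧ not (touches3 x a b c)) + count2 (Φ x) ∎
    where
    open ≡-Reasoning
    T : Fin n → Fin n → Fin n → Bool
    T a b c = (a <ᵇ b) ∧ ((b <ᵇ c) ∧ Φ a b c)
    t : Fin n → Fin n → Fin n → ℕ
    t a b c = [ T a b c ]

    reassociate : ∀ a b c → T a b c ∧ not (touches3 x a b c) ≡ (a <ᵇ b) ∧ ((b <ᵇ c) ∧ (Φ a b c ∧ not (touches3 x a b c)))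
    reassociate a b c = trans (∧-assoc (a <ᵇ b) _ _) (cong ((a <ᵇ b) ∧_) (∧-assoc (b <ᵇ c) _ _))

    at-first : Σ3 (λ a b c → [ a == x ] * t a b c) ≡ ΣΣ (t x)
    at-first = trans (Σ-cong (λ a → trans (Σ-cong (λ b → Σ-*ˡ [ a == x ] (t a b))) (Σ-*ˡ [ a == x ] (λ b → Σ[] (t a b)))))
                     (Σ-point x (λ a → ΣΣ (t a)))
    at-second : Σ3 (λ a b c → [ b == x ] * t a b c) ≡ ΣΣ (λ a c → t a x c)
    at-second = Σ-cong (λ a → trans (Σ-cong (λ b → Σ-*ˡ [ b == x ] (t a b))) (Σ-point x (λ b → Σ[] (t a b))))
    at-third : Σ3 (λ a b c → [ c == x ] * t a b c) ≡ ΣΣ (λ a b → t a b x)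
    at-third = Σ-cong (λ a → Σ-cong (λ b → Σ-point x (t a b)))

    -- the three positions of x, after moving x to the front with the symmetry of Φ
    regroup : ∀ u v → t x u v + (t u x v + t u v x)
      ≡ [ (x <ᵇ u) ∧ ((u <ᵇ v) ∧ Φ x u v) ] + ([ (u <ᵇ x) ∧ ((x <ᵇ v) ∧ Φ x u v) ] + [ (u <ᵇ v) ∧ ((v <ᵇ x) ∧ Φ x u v) ])
    regroup u v = cong₂ (λ p q → t x u v + ([ (u <ᵇ x) ∧ ((x <ᵇ v) ∧ p) ] + [ (u <ᵇ v) ∧ ((v <ᵇ x) ∧ q) ]))
                        (sym (s₁₂ x u v)) (trans (sym (s₂₃ u x v)) (sym (s₁₂ x u v)))

    through-x : Σ3 (λ a b c → [ T a b c ∧ touches3 x a b c ]) ≡ count2 (Φ x)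
    through-x = begin
      Σ3 (λ a b c → [ T a b c ∧ touches3 x a b c ])
        ≡⟨ Σ3-cong (λ a b c → increasing-touches x a b c (Φ a b c)) ⟩
      Σ3 (λ a b c → [ a == x ] * t a b c + ([ b == x ] * t a b c + [ c == x ] * t a b c))
        ≡⟨ Σ3-+ (λ a b c → [ a == x ] * t a b c) (λ a b c → [ b == x ] * t a b c + [ c == x ] * t a b c) ⟩
      Σ3 (λ a b c → [ a == x ] * t a b c) + Σ3 (λ a b c → [ b == x ] * t a b c + [ c == x ] * t a b c)
        ≡⟨ cong₂ _+_ at-first (trans (Σ3-+ (λ a b c → [ b == x ] * t a b c) (λ a b c → [ c == x ] * t a b c))
                                     (cong₂ _+_ at-second at-third)) ⟩
      ΣΣ (t x) + (ΣΣ (λ a c → t a x c) + ΣΣ (λ a b → t a b x))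
        ≡⟨ cong (ΣΣ (t x) +_) (ΣΣ-+ (λ u v → t u x v) (λ u v → t u v x)) ⟨
      ΣΣ (t x) + ΣΣ (λ u v → t u x v + t u v x)
        ≡⟨ ΣΣ-+ (t x) (λ u v → t u x v + t u v x) ⟨
      ΣΣ (λ u v → t x u v + (t u x v + t u v x))
        ≡⟨ ΣΣ-cong (λ u v → trans (regroup u v) (sym (sorted-positions x u v (Φ x u v) (avoid-x u v)))) ⟩
      count2 (Φ x) ∎

  ∧-reverse : ∀ a b c → a ∧ (b ∧ c) ≡ c ∧ (b ∧ a)
  ∧-reverse a b c = trans (sym (∧-assoc a b c)) (trans (∧-comm (a ∧ b) c) (cong (c ∧_) (∧-comm a b)))

  allDistinct-swap₁₂ : ∀ i j k → allDistinct i j k ≡ allDistinct j i k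
  allDistinct-swap₁₂ i j k rewrite ==-sym j i = cong (not (i == j) ∧_) (∧-comm (not (j == k)) (not (i == k)))

  allDistinct-swap₂₃ : ∀ i j k → allDistinct i j k ≡ allDistinct i k j
  allDistinct-swap₂₃ i j k rewrite ==-sym k j = ∧-reverse (not (i == j)) (not (j == k)) (not (i == k))

  -- with x in U_1 (resp. U_3, U_2), its crossing link pairs are those of L_{2,3} (resp. L_{1,2}, L_{1,3})
  allDistinct-1 : ∀ p q → allDistinct zero p q ≡ ((p == suc zero ∧ q == suc (suc zero)) ∨ (p == suc (suc zero) ∧ q == suc zero))
  allDistinct-1 zero             q                = refl
  allDistinct-1 (suc zero)       zero             = refl
  allDistinct-1 (suc zero)       (suc zero)       = refl
  allDistinct-1 (suc zero)       (suc (suc zero)) = refl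
  allDistinct-1 (suc (suc zero)) zero             = refl
  allDistinct-1 (suc (suc zero)) (suc zero)       = refl
  allDistinct-1 (suc (suc zero)) (suc (suc zero)) = refl

  allDistinct-3 : ∀ p q → allDistinct (suc (suc zero)) p q ≡ ((p == zero ∧ q == suc zero) ∨ (p == suc zero ∧ q == zero))
  allDistinct-3 zero             zero             = refl
  allDistinct-3 zero             (suc zero)       = refl
  allDistinct-3 zero             (suc (suc zero)) = refl
  allDistinct-3 (suc zero)       zero             = refl
  allDistinct-3 (suc zero)       (suc zero)       = refl
  allDistinct-3 (suc zero)       (suc (suc zero)) = refl
  allDistinct-3 (suc (suc zero)) q                = refl

  allDistinct-2 : ∀ p q → allDistinct (suc zero) p q ≡ ((p == zero ∧ q == suc (suc zero)) ∨ (p == suc (suc zero) ∧ q == zero))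
  allDistinct-2 zero             zero             = refl
  allDistinct-2 zero             (suc zero)       = refl
  allDistinct-2 zero             (suc (suc zero)) = refl
  allDistinct-2 (suc zero)       q                = refl
  allDistinct-2 (suc (suc zero)) zero             = refl
  allDistinct-2 (suc (suc zero)) (suc zero)       = refl
  allDistinct-2 (suc (suc zero)) (suc (suc zero)) = refl

  module Move {n : ℕ} (H : ThreeGraph n) (P : Partition n) (x : Fin n) where

    moved : Fin 3 → Partition n
    moved k v = if v == x then k else P v

    moved-here : ∀ k → moved k x ≡ k
    moved-here k rewrite ==-refl x = refl

    moved-away : ∀ k v → v ≢ x → moved k v ≡ P v
    moved-away k v v≢x rewrite ==-false v x v≢x = refl

    noncross : Partition n → Fin n → Fin n → Fin n → Bool
    noncross R a b c = edge H a b c ∧ not (allDistinct (R a) (R b) (R c))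

    crossing : Fin 3 → Fin n → Fin n → Bool
    crossing k u v = edge H x u v ∧ allDistinct k (P u) (P v)

    noncross-sym : ∀ R → Symmetric3 (noncross R)
    noncross-sym R = (λ a b c → cong₂ _∧_ (sym₁₂ H a b c) (cong not (allDistinct-swap₁₂ (R a) (R b) (R c)))) ,
                     (λ a b c → cong₂ _∧_ (sym₂₃ H a b c) (cong not (allDistinct-swap₂₃ (R a) (R b) (R c))))

    edge-at-x : ∀ u v → edge H x u v ≡ true → (x ≢ u) × (x ≢ v)
    edge-at-x u v e with nondeg H x u v e
    ... | x≢u , _ , x≢v = x≢u , x≢v

    away-unchanged : ∀ k a b c → noncross P a b c ∧ not (touches3 x a b c) ≡ noncross (moved k) a b c ∧ not (touches3 x a b c)
    away-unchanged k a b c with a ≟ x | b ≟ x | c ≟ x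
    ... | no _ | no _ | no _ = refl
    ... | yes _ | _ | _ = trans (∧-zeroʳ _) (sym (∧-zeroʳ _))
    ... | no _ | yes _ | _ = trans (∧-zeroʳ _) (sym (∧-zeroʳ _))
    ... | no _ | no _ | yes _ = trans (∧-zeroʳ _) (sym (∧-zeroʳ _))

    at-x : ∀ R k → R x ≡ k → (∀ v → v ≢ x → R v ≡ P v) →
           count2 (noncross R x) + count2 (crossing k) ≡ count2 (edge H x)
    at-x R k Rx R-away = trans (sym (ΣΣ-+ (λ u v → [ (u <ᵇ v) ∧ noncross R x u v ]) (λ u v → [ (u <ᵇ v) ∧ crossing k u v ])))
                               (ΣΣ-cong pointwise)
      where
      pointwise : ∀ u v → [ (u <ᵇ v) ∧ noncross R x u v ] + [ (u <ᵇ v) ∧ crossing k u v ] ≡ [ (u <ᵇ v) ∧ edge H x u v ]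
      pointwise u v with edge H x u v in e
      ... | false rewrite ∧-zeroʳ (u <ᵇ v) = refl
      ... | true with edge-at-x u v e
      ...   | x≢u , x≢v rewrite Rx | R-away u (λ q → x≢u (sym q)) | R-away v (λ q → x≢v (sym q)) =
              trans (sym ([]-split (u <ᵇ v) (allDistinct k (P u) (P v)))) (cong [_] (sym (∧-identityʳ (u <ᵇ v))))

    -- In an optimal partition x has at least as many crossing link pairs as it
    -- would have in any other part: otherwise moving x reduces D_H.
    optimal-crossing : Optimal H P → ∀ k → count2 (crossing k) ≤ count2 (crossing (P x))
    optimal-crossing opt k = +-cancelˡ-≤ (count2 (noncross Q x)) _ _ (begin
      count2 (noncross Q x) + count2 (crossing k)
        ≡⟨ at-x Q k (moved-here k) (moved-away k) ⟩
      count2 (edge H x)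
        ≡⟨ at-x P (P x) refl (λ _ _ → refl) ⟨
      count2 (noncross P x) + count2 (crossing (P x))
        ≤⟨ +-monoˡ-≤ _ at-x-fewer ⟩
      count2 (noncross Q x) + count2 (crossing (P x)) ∎)
      where
      open ≤-Reasoning
      Q = moved k
      avoiding : Partition n → ℕ
      avoiding R = count3 (λ a b c → noncross R a b c ∧ not (touches3 x a b c))
      split : ∀ R → nonCrossing H R ≡ avoiding R + count2 (noncross R x)
      split R = count3-at (noncross R) x (noncross-sym R) (λ u v e → edge-at-x u v (proj₁ (∧-elim {edge H x u v} e)))
      at-x-fewer : count2 (noncross P x) ≤ count2 (noncross Q x)
      at-x-fewer = +-cancelˡ-≤ (avoiding P) _ _ (begin
        avoiding P + count2 (noncross P x) ≡⟨ split P ⟨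
        nonCrossing H P                    ≤⟨ opt Q ⟩
        nonCrossing H Q                    ≡⟨ split Q ⟩
        avoiding Q + count2 (noncross Q x) ≡⟨ cong (_+ count2 (noncross Q x)) (Σ3-cong (λ a b c →
                                                cong (λ t → [ (a <ᵇ b) ∧ ((b <ᵇ c) ∧ t) ]) (away-unchanged k a b c))) ⟨
        avoiding P + count2 (noncross Q x) ∎)

    optimal-link : Optimal H P → P x ≡ zero →
      (Lsize H P x zero (suc zero) ≤ Lsize H P x (suc zero) (suc (suc zero))) ×
      (Lsize H P x zero (suc (suc zero)) ≤ Lsize H P x (suc zero) (suc (suc zero)))
    optimal-link opt px = subst₂ _≤_ (as-link {suc (suc zero)} allDistinct-3) in-U₁ (optimal-crossing opt (suc (suc zero))) ,
                          subst₂ _≤_ (as-link {suc zero} allDistinct-2) in-U₁ (optimal-crossing opt (suc zero))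
      where
      as-link : ∀ {k i j} → (∀ p q → allDistinct k p q ≡ ((p == i ∧ q == j) ∨ (p == j ∧ q == i))) →
                count2 (crossing k) ≡ Lsize H P x i j
      as-link table = ΣΣ-cong (λ u v → cong (λ t → [ (u <ᵇ v) ∧ (edge H x u v ∧ t) ]) (table (P u) (P v)))
      in-U₁ : count2 (crossing (P x)) ≡ Lsize H P x (suc zero) (suc (suc zero))
      in-U₁ rewrite px = as-link {zero} allDistinct-1

  ∨-false : ∀ {b c} → b ∨ c ≡ false → (b ≡ false) × (c ≡ false)
  ∨-false {false} e = refl , e

  ==-false-≢ : ∀ {n} {a b : Fin n} → (a == b) ≡ false → a ≢ b
  ==-false-≢ {a = a} e refl = subst (λ t → t ≡ false → ⊥) (sym (==-refl a)) (λ ()) e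

  half-of-two : ∀ m → m + m ≡ 2 → m ≡ 1
  half-of-two 1 _ = refl
  half-of-two (suc (suc m)) e = ⊥-elim (m+1+n≢0 m (suc-injective (suc-injective e)))

  module Greedy {n : ℕ} (P : Partition n) (l : Fin 3) where

    Graph : (Fin n → Fin n → Bool) → Set
    Graph E = (∀ a b → E a b ≡ E b a) × (∀ a → E a a ≡ false) × (∀ a b → E a b ≡ true → P a ≡ l)

    _⊆_ : (M E : Fin n → Fin n → Bool) → Set
    M ⊆ E = ∀ a b → M a b ≡ true → E a b ≡ true

    avoid : Fin n → Fin n → (Fin n → Fin n → Bool) → Fin n → Fin n → Bool
    avoid u v E a b = E a b ∧ not (touches u a b ∨ touches v a b)

    avoid-graph : ∀ u v E → Graph E → Graph (avoid u v E)
    avoid-graph u v E (E-sym , E-irr , E-part) =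
      (λ a b → cong₂ _∧_ (E-sym a b) (cong not (cong₂ _∨_ (∨-comm (a == u) (b == u)) (∨-comm (a == v) (b == v))))) ,
      (λ a → cong (_∧ _) (E-irr a)) ,
      (λ a b e → E-part a b (proj₁ (∧-elim e)))

    avoid-≢ : ∀ u v E a b → avoid u v E a b ≡ true → (a ≢ u) × (a ≢ v)
    avoid-≢ u v E a b e with ∨-false {touches u a b} (not-true (proj₂ (∧-elim {E a b} e)))
    ... | tu , tv = ==-false-≢ (proj₁ (∨-false tu)) , ==-false-≢ (proj₁ (∨-false tv))

    avoid-bound : ∀ u v E → count2 E ≤ count2 (avoid u v E) + (n + n)
    avoid-bound u v E = begin
      count2 E
        ≤⟨ ΣΣ-mono point ⟩
      ΣΣ (λ a b → [ (a <ᵇ b) ∧ avoid u v E a b ] + ([ (a <ᵇ b) ∧ touches u a b ] + [ (a <ᵇ b) ∧ touches v a b ]))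
        ≡⟨ ΣΣ-+ (λ a b → [ (a <ᵇ b) ∧ avoid u v E a b ]) _ ⟩
      count2 (avoid u v E) + ΣΣ (λ a b → [ (a <ᵇ b) ∧ touches u a b ] + [ (a <ᵇ b) ∧ touches v a b ])
        ≡⟨ cong (count2 (avoid u v E) +_) (ΣΣ-+ (λ a b → [ (a <ᵇ b) ∧ touches u a b ]) _) ⟩
      count2 (avoid u v E) + (count2 (touches u) + count2 (touches v))
        ≤⟨ +-monoʳ-≤ (count2 (avoid u v E)) (+-mono-≤ (count2-touches u) (count2-touches v)) ⟩
      count2 (avoid u v E) + (n + n) ∎
      where
      open ≤-Reasoning
      point : ∀ a b → [ (a <ᵇ b) ∧ E a b ]
                    ≤ [ (a <ᵇ b) ∧ avoid u v E a b ] + ([ (a <ᵇ b) ∧ touches u a b ] + [ (a <ᵇ b) ∧ touches v a b ])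
      point a b with E a b
      ... | false rewrite ∧-zeroʳ (a <ᵇ b) = z≤n
      ... | true = begin
        [ (a <ᵇ b) ∧ true ]
          ≡⟨ cong [_] (∧-identityʳ (a <ᵇ b)) ⟩
        [ a <ᵇ b ]
          ≡⟨ []-split (a <ᵇ b) t ⟩
        [ (a <ᵇ b) ∧ not t ] + [ (a <ᵇ b) ∧ t ]
          ≤⟨ +-monoʳ-≤ [ (a <ᵇ b) ∧ not t ] (≤-trans (≤-reflexive (cong [_] (∧-distribˡ-∨ (a <ᵇ b) _ _)))
                                                      ([∨]≤ ((a <ᵇ b) ∧ touches u a b) _)) ⟩
        [ (a <ᵇ b) ∧ not t ] + ([ (a <ᵇ b) ∧ touches u a b ] + [ (a <ᵇ b) ∧ touches v a b ]) ∎
        where t = touches u a b ∨ touches v a b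

    pair : Fin n → Fin n → Fin n → Fin n → Bool
    pair u v a b = (a == u ∧ b == v) ∨ (a == v ∧ b == u)

    pair-elim : ∀ u v a b → pair u v a b ≡ true → ((a ≡ u) × (b ≡ v)) ⊎ ((a ≡ v) × (b ≡ u))
    pair-elim u v a b e with ∨-elim {a == u ∧ b == v} e
    ... | inj₁ p = let (au , bv) = ∧-elim p in inj₁ (==-sound a u au , ==-sound b v bv)
    ... | inj₂ p = let (av , bu) = ∧-elim p in inj₂ (==-sound a v av , ==-sound b u bu)

    module AddPair (E : Fin n → Fin n → Bool) (graph : Graph E) (u v : Fin n) (u<v : (u <ᵇ v) ≡ true)
                   (Euv : E u v ≡ true) (M : Fin n → Fin n → Bool) (matching : Matching P l M)
                   (M⊆ : M ⊆ avoid u v E) where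

      M+uv : Fin n → Fin n → Bool
      M+uv a b = M a b ∨ pair u v a b

      u≢v : u ≢ v
      u≢v = <ᵇ-sound u v u<v

      M-off : ∀ a b → M a b ≡ true → (a ≢ u) × (a ≢ v)
      M-off a b m = avoid-≢ u v E a b (M⊆ a b m)

      M-pair-disjoint : ∀ a b c → M a b ≡ true → pair u v a c ≡ true → ⊥
      M-pair-disjoint a b c m p with pair-elim u v a c p
      ... | inj₁ (au , _) = proj₁ (M-off a b m) au
      ... | inj₂ (av , _) = proj₂ (M-off a b m) av

      pair-sym : ∀ a b → pair u v a b ≡ pair u v b a
      pair-sym a b = trans (∨-comm (a == u ∧ b == v) _) (cong₂ _∨_ (∧-comm (a == v) _) (∧-comm (a == u) _))

      pair-irrefl : ∀ a → pair u v a a ≡ false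
      pair-irrefl a = cong₂ _∨_ (∧-false (a == u) (λ au → ==-false a v (λ av → u≢v (trans (sym (==-sound a u au)) av))))
                                (∧-false (a == v) (λ av → ==-false a u (λ au → u≢v (trans (sym au) (==-sound a v av)))))

      count2-pair : count2 (pair u v) ≡ 1
      count2-pair = half-of-two _ (trans (count2-symmetric (pair u v) pair-irrefl pair-sym) (begin
        ΣΣ (λ a b → [ pair u v a b ])
          ≡⟨ ΣΣ-cong (λ a b → [∨]-disjoint (a == u ∧ b == v) _ (λ p q →
               u≢v (trans (sym (==-sound a u (proj₁ (∧-elim p)))) (==-sound a v (proj₁ (∧-elim q)))))) ⟩
        ΣΣ (λ a b → [ a == u ∧ b == v ] + [ a == v ∧ b == u ])
          ≡⟨ ΣΣ-+ (λ a b → [ a == u ∧ b == v ]) (λ a b → [ a == v ∧ b == u ]) ⟩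
        ΣΣ (λ a b → [ a == u ∧ b == v ]) + ΣΣ (λ a b → [ a == v ∧ b == u ])
          ≡⟨ cong₂ _+_ (trans (ΣΣ-product (_== u) (_== v)) (cong₂ _*_ (singleton u) (singleton v)))
                       (trans (ΣΣ-product (_== v) (_== u)) (cong₂ _*_ (singleton v) (singleton u))) ⟩
        2 ∎))
        where
        open ≡-Reasoning
        singleton : ∀ w → size (_== w) ≡ 1
        singleton w = trans (Σ-cong (λ a → sym (*-identityʳ [ a == w ]))) (Σ-point w (λ _ → 1))

      addPair-matching : Matching P l M+uv
      addPair-matching = M+uv-sym , M+uv-irrefl , M+uv-functional , M+uv-part
        where
        M-sym = proj₁ matching
        M-irr = proj₁ (proj₂ matching)
        M-fun = proj₁ (proj₂ (proj₂ matching))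
        M-part = proj₂ (proj₂ (proj₂ matching))
        M+uv-sym : ∀ a b → M+uv a b ≡ M+uv b a
        M+uv-sym a b = cong₂ _∨_ (M-sym a b) (pair-sym a b)
        M+uv-irrefl : ∀ a → M+uv a a ≡ false
        M+uv-irrefl a = cong₂ _∨_ (M-irr a) (pair-irrefl a)
        M+uv-functional : ∀ a b c → M+uv a b ≡ true → M+uv a c ≡ true → b ≡ c
        M+uv-functional a b c p q with ∨-elim {M a b} p | ∨-elim {M a c} q
        ... | inj₁ mb | inj₁ mc = M-fun a b c mb mc
        ... | inj₁ mb | inj₂ pc = ⊥-elim (M-pair-disjoint a b c mb pc)
        ... | inj₂ pb | inj₁ mc = ⊥-elim (M-pair-disjoint a c b mc pb)
        ... | inj₂ pb | inj₂ pc with pair-elim u v a b pb | pair-elim u v a c pc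
        ...   | inj₁ (_ , bv) | inj₁ (_ , cv) = trans bv (sym cv)
        ...   | inj₂ (_ , bu) | inj₂ (_ , cu) = trans bu (sym cu)
        ...   | inj₁ (au , _) | inj₂ (av , _) = ⊥-elim (u≢v (trans (sym au) av))
        ...   | inj₂ (av , _) | inj₁ (au , _) = ⊥-elim (u≢v (trans (sym au) av))
        M+uv-part : ∀ a b → M+uv a b ≡ true → P a ≡ l
        M+uv-part a b p with ∨-elim {M a b} p
        ... | inj₁ m = M-part a b m
        ... | inj₂ pp with pair-elim u v a b pp
        ...   | inj₁ (refl , refl) = proj₂ (proj₂ graph) a b Euv
        ...   | inj₂ (refl , refl) = proj₂ (proj₂ graph) a b (trans (proj₁ graph a b) Euv)

      addPair-⊆ : M+uv ⊆ E
      addPair-⊆ a b p with ∨-elim {M a b} p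
      ... | inj₁ m = proj₁ (∧-elim (M⊆ a b m))
      ... | inj₂ pp with pair-elim u v a b pp
      ...   | inj₁ (refl , refl) = Euv
      ...   | inj₂ (refl , refl) = trans (proj₁ graph a b) Euv

      addPair-count : count2 M+uv ≡ suc (count2 M)
      addPair-count = begin
        count2 M+uv
          ≡⟨ ΣΣ-cong (λ a b → [∧∨]-disjoint (a <ᵇ b) (M a b) (pair u v a b) (λ _ → M-pair-disjoint a b b)) ⟩
        ΣΣ (λ a b → [ (a <ᵇ b) ∧ M a b ] + [ (a <ᵇ b) ∧ pair u v a b ])
          ≡⟨ ΣΣ-+ (λ a b → [ (a <ᵇ b) ∧ M a b ]) (λ a b → [ (a <ᵇ b) ∧ pair u v a b ]) ⟩
        count2 M + count2 (pair u v)
          ≡⟨ cong (count2 M +_) count2-pair ⟩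
        count2 M + 1
          ≡⟨ +-comm (count2 M) 1 ⟩
        suc (count2 M) ∎
        where open ≡-Reasoning

    BigMatching : (Fin n → Fin n → Bool) → ℕ → Set
    BigMatching E k = ∃[ M ] (Matching P l M × M ⊆ E × count2 M ≡ suc k)

    empty-matching : Matching P l (λ _ _ → false)
    empty-matching = (λ _ _ → refl) , (λ _ → refl) , (λ _ _ _ ()) , (λ _ _ ())

    -- Greedily pick a pair and discard everything through it: either we find
    -- k + 1 disjoint pairs, or k rounds have removed every pair of E.
    greedy : ∀ k E → Graph E → BigMatching E k ⊎ (count2 E ≤ k * (n + n))
    greedy k E graph with count2 E in cE
    ... | zero = inj₂ z≤n
    ... | suc _ with count2-witness E (subst (0 <_) (sym cE) (s≤s z≤n))
    ...   | u , v , u<v , Euv = subst (λ c → BigMatching E k ⊎ (c ≤ k * (n + n))) cE (grow k)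
      where
      extend : ∀ {j} M → Matching P l M → M ⊆ avoid u v E → count2 M ≡ j → BigMatching E j
      extend M m M⊆ cM = M+uv , addPair-matching , addPair-⊆ , trans addPair-count (cong suc cM)
        where open AddPair E graph u v u<v Euv M m M⊆
      grow : ∀ k → BigMatching E k ⊎ (count2 E ≤ k * (n + n))
      grow zero = inj₁ (extend (λ _ _ → false) empty-matching (λ _ _ ()) (Σ-zero {n} (λ a → Σ-zero {n} (λ b → cong [_] (∧-zeroʳ (a <ᵇ b))))))
      grow (suc j) with greedy j (avoid u v E) (avoid-graph u v E graph)
      ... | inj₁ (M , m , M⊆ , cM) = inj₁ (extend M m M⊆ cM)
      ... | inj₂ bound = inj₂ (≤-trans (avoid-bound u v E)
                                       (≤-trans (+-monoˡ-≤ (n + n) bound) (≤-reflexive (+-comm (j * (n + n)) (n + n)))))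

  F5-copy : ∀ {n} (H : ThreeGraph n) → F5-free H → (v₀ v₁ v₂ v₃ v₄ : Fin n) →
    Unique (v₀ ∷ v₁ ∷ v₂ ∷ v₃ ∷ v₄ ∷ []) →
    edge H v₀ v₁ v₂ ≡ true → edge H v₀ v₁ v₃ ≡ true → edge H v₂ v₃ v₄ ≡ true → ⊥
  F5-copy H free v₀ v₁ v₂ v₃ v₄ distinct e₁ e₂ e₃ =
    free (lookup (v₀ ∷ v₁ ∷ v₂ ∷ v₃ ∷ v₄ ∷ []) , lookup-injective distinct , e₁ , e₂ , e₃)

  edge-rotate : ∀ {n} (H : ThreeGraph n) a b c → edge H a b c ≡ edge H b c a
  edge-rotate H a b c = trans (sym₁₂ H a b c) (sym₂₃ H b a c)

  dominated : ∀ {s y f T} → 129 ≤ s → 0 < y → s * y ≤ 2 ^ 7 * T → f ≤ y → f < T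
  dominated {s} {y} {f} {T} big pos dense f≤y = ≰⇒> λ T≤f → <-irrefl refl (begin-strict
    2 ^ 7 * y  <⟨ *-monoˡ-< y {{ℕ.>-nonZero pos}} (n<1+n 128) ⟩
    129 * y    ≤⟨ *-monoˡ-≤ y big ⟩
    s * y      ≤⟨ dense ⟩
    2 ^ 7 * T  ≤⟨ *-monoʳ-≤ (2 ^ 7) (≤-trans T≤f f≤y) ⟩
    2 ^ 7 * y  ∎)
    where open ≤-Reasoning

  [∧⁵]≤ : ∀ p q r s t → [ p ∧ (q ∧ (r ∧ (s ∧ t))) ] ≤ [ r ] * [ p ∧ s ]
  [∧⁵]≤ false q     r     s     t = z≤n
  [∧⁵]≤ true  false r     s     t = z≤n
  [∧⁵]≤ true  true  false s     t = z≤n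
  [∧⁵]≤ true  true  true  false t = z≤n
  [∧⁵]≤ true  true  true  true  t = []≤1 t

  module DenseMatching {n : ℕ} (H : ThreeGraph n) (free : F5-free H) (P : Partition n) (x : Fin n)
                       {i j l : Fin 3} (parts : Distinct3 i j l) (j≢x : j ≢ P x)
                       (M : Fin n → Fin n → Bool) (matching : Matching P l M)
                       (M-link : ∀ c d → M c d ≡ true → edge H x c d ≡ true) where

    twins : Fin n → ℕ
    twins a = Σ[] λ b → count2 λ c d → U P i a ∧ U P j b ∧ M c d ∧ edge H a b c ∧ edge H a b d

    twins-at-x : twins x ≤ size (U P j) * count2 M
    twins-at-x = begin
      twins x
        ≤⟨ Σ-mono (λ b → ΣΣ-mono (λ c d → [∧⁵]≤ (c <ᵇ d) (U P i x) (U P j b) (M c d) _)) ⟩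
      Σ[] (λ b → ΣΣ (λ c d → [ U P j b ] * [ (c <ᵇ d) ∧ M c d ]))
        ≡⟨ Σ-cong (λ b → trans (Σ-cong (λ c → Σ-*ˡ [ U P j b ] (λ d → [ (c <ᵇ d) ∧ M c d ])))
                                   (Σ-*ˡ [ U P j b ] (λ c → Σ[] (λ d → [ (c <ᵇ d) ∧ M c d ])))) ⟩
      Σ[] (λ b → [ U P j b ] * count2 M)
        ≡⟨ Σ-*ʳ (count2 M) (λ b → [ U P j b ]) ⟩
      size (U P j) * count2 M ∎
      where open ≤-Reasoning

    -- a twin pair at a ≠ x together with the link pair {c,d} of x is a copy of F₅
    twin-F5 : ∀ a → a ≢ x → 0 < twins a → ⊥
    twin-F5 a a≢x t-pos with Σ-witness _ t-pos
    ... | b , tb with count2-witness _ tb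
    ...   | c , d , c<d , all with ∧-elim {U P i a} all
    ...     | ai , rest with ∧-elim {U P j b} rest
    ...       | bj , rest′ with ∧-elim {M c d} rest′
    ...         | mcd , edges with ∧-elim {edge H a b c} edges
    ...           | abc , abd = F5-copy H free a b c d x distinct abc abd (trans (sym (edge-rotate H x c d)) xcd)
      where
      pa = ==-sound (P a) i ai
      pb = ==-sound (P b) j bj
      pc = proj₂ (proj₂ (proj₂ matching)) c d mcd
      pd = proj₂ (proj₂ (proj₂ matching)) d c (trans (proj₁ matching d c) mcd)
      xcd = M-link c d mcd
      i≢j = proj₁ parts
      j≢l = proj₁ (proj₂ parts)
      i≢l = proj₂ (proj₂ parts)
      x-off = nondeg H x c d xcd
      distinct : Unique (a ∷ b ∷ c ∷ d ∷ x ∷ [])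
      distinct = (part-≢ P pa pb i≢j ∷ part-≢ P pa pc i≢l ∷ part-≢ P pa pd i≢l ∷ a≢x ∷ [])
               ∷ (part-≢ P pb pc j≢l ∷ part-≢ P pb pd j≢l ∷ part-≢ P pb refl j≢x ∷ [])
               ∷ (<ᵇ-sound c d c<d ∷ (λ e → proj₁ x-off (sym e)) ∷ [])
               ∷ ((λ e → proj₂ (proj₂ x-off) (sym e)) ∷ [])
               ∷ [] ∷ []

    matching-F5 : 129 ≤ size (U P i) → 0 < size (U P j) * count2 M →
      size (U P i) * size (U P j) * count2 M ≤ 2 ^ 7 * Σ[] twins → ⊥
    matching-F5 big pos dense =
      let (a , a≢x , t-pos) = Σ-witness-≢ twins x (dominated {size (U P i)} {size (U P j) * count2 M} {twins x} {Σ[] twins}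
                                big pos (≤-trans (≤-reflexive (sym (*-assoc (size (U P i)) (size (U P j)) (count2 M)))) dense) twins-at-x)
      in twin-F5 a a≢x t-pos

  []-one : ∀ b → [ b ] ≡ 1 → b ≡ true
  []-one true _ = refl

  count3-none : ∀ {n} (Φ : Fin n → Fin n → Fin n → Bool) → (∀ a b c → Φ a b c ≡ true → ⊥) → count3 Φ ≡ 0
  count3-none {n} Φ none = Σ-zero {n} λ a → Σ-zero {n} λ b → Σ-zero {n} λ c →
    cong [_] (trans (cong (λ t → (a <ᵇ b) ∧ ((b <ᵇ c) ∧ t)) (no-instance a b c))
                    (trans (cong ((a <ᵇ b) ∧_) (∧-zeroʳ (b <ᵇ c))) (∧-zeroʳ (a <ᵇ b))))
    where
    no-instance : ∀ a b c → Φ a b c ≡ false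
    no-instance a b c with Φ a b c in e
    ... | true  = ⊥-elim (none a b c e)
    ... | false = refl

  split-off : ∀ {n} (H : ThreeGraph n) (A : Fin n → Bool) (G : Fin n → Fin n → Bool) a b c →
    edge H a b c ≡ true → meet1 A a b c ≡ true → restIn A G a b c ≡ true →
    ∃[ u ] ∃[ w₁ ] ∃[ w₂ ] (A u ≡ true × G w₁ w₂ ≡ true × edge H u w₁ w₂ ≡ true)
  split-off H A G a b c abc once rest with A a in Aa
  ... | true with ∨-elim {G b c} rest
  ...   | inj₁ g = a , b , c , Aa , g , abc
  ...   | inj₂ g = a , c , b , Aa , g , trans (sym (sym₂₃ H a b c)) abc
  split-off H A G a b c abc once rest | false with A b in Ab
  ... | true with ∨-elim {G a c} rest
  ...   | inj₁ g = b , a , c , Ab , g , trans (sym (sym₁₂ H a b c)) abc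
  ...   | inj₂ g = b , c , a , Ab , g , trans (sym (edge-rotate H a b c)) abc
  split-off H A G a b c abc once rest | false | false with ∨-elim {G a b} rest
  ... | inj₁ g = c , a , b , Ac , g , cab
    where
    Ac = []-one (A c) (isYes-sound ([ A c ] ℕ.≟ 1) once)
    cab = trans (sym (trans (edge-rotate H a b c) (edge-rotate H b c a))) abc
  ... | inj₂ g = c , b , a , Ac , g , trans (sym₂₃ H c b a) cab
    where
    Ac = []-one (A c) (isYes-sound ([ A c ] ℕ.≟ 1) once)
    cab = trans (sym (trans (edge-rotate H a b c) (edge-rotate H b c a))) abc

  module Star {n : ℕ} (H : ThreeGraph n) (free : F5-free H) (P : Partition n) (x : Fin n)
              {i k k₂ : Fin 3} (parts : Distinct3 i k k₂) (px : P x ≡ i) where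
    open Link H P x

    degree : Fin n → ℕ
    degree u = Σ[] (λ v → [ link→ i k u v ])

    star : Fin n → Bool
    star u = (P u == i) ∧ ⌊ 2 ℕ.≤? degree u ⌋

    star-sub : SubPart P i star
    star-sub u e = ==-sound (P u) i (proj₁ (∧-elim e))

    count-bound : ∀ (p : Bool) d → (p ≡ false → d ≡ 0) → d ≤ n → d ≤ [ p ∧ ⌊ 2 ℕ.≤? d ⌋ ] * n + 1
    count-bound false d off _ = ≤-trans (≤-reflexive (off refl)) z≤n
    count-bound true d _ d≤n with 2 ℕ.≤? d
    ... | yes _ = ≤-trans d≤n (≤-trans (≤-reflexive (sym (+-identityʳ n))) (m≤m+n (n + 0) 1))
    ... | no ≱2 = ≤-pred (≰⇒> ≱2)

    degree-bound : ∀ u → degree u ≤ [ star u ] * n + 1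
    degree-bound u = count-bound (P u == i) (degree u)
      (λ off → Σ-zero (λ v → cong [_] (trans (cong (λ t → edge H x u v ∧ (t ∧ (P v == k))) off) (∧-zeroʳ (edge H x u v)))))
      (size≤ (link→ i k u))

    -- |L_{i,k}(x)| ≤ |S| n + n: a vertex outside S has at most one link neighbour
    star-bound : Lsize H P x i k ≤ size star * n + n
    star-bound = begin
      Lsize H P x i k                      ≡⟨ Lsize-ordered i k (proj₁ parts) ⟩
      Σ[] degree                           ≤⟨ Σ-mono degree-bound ⟩
      Σ[] (λ u → [ star u ] * n + 1)       ≡⟨ Σ-+ (λ u → [ star u ] * n) (λ _ → 1) ⟩
      Σ[] (λ u → [ star u ] * n) + Σ[] {n} (λ _ → 1)
        ≡⟨ cong₂ _+_ (Σ-*ʳ n (λ u → [ star u ])) (trans (Σ-const {n} 1) (*-identityʳ n)) ⟩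
      size star * n + n ∎
      where open ≤-Reasoning

    -- A star vertex u on an edge u w₁ w₂, where w₁ ∈ U_k and w₂ ∈ U_{k₂} are linked to x,
    -- has a link neighbour v ≠ w₁ in U_k; then w₁w₂x, w₁w₂u, xuv form a copy of F₅.
    star-F5 : ∀ u w₁ w₂ → star u ≡ true → link→ k k₂ w₁ w₂ ≡ true → edge H u w₁ w₂ ≡ true → ⊥
    star-F5 u w₁ w₂ su g uw₁w₂ =
      let two≤degree = isYes-sound (2 ℕ.≤? degree u) (proj₂ (∧-elim su))
          (v , v≢w₁ , uv) = Σ-witness-≢ (λ v → [ link→ i k u v ]) w₁ (<-≤-trans (s≤s ([]≤1 _)) two≤degree)
      in F5-copy H free w₁ w₂ x u v (distinct v v≢w₁ uv)
           (trans (sym (edge-rotate H x w₁ w₂)) (proj₁ (∧-elim g)))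
           (trans (sym (edge-rotate H u w₁ w₂)) uw₁w₂)
           (proj₁ (∧-elim ([]-true _ uv)))
      where
      k≢i : k ≢ i
      k≢i e = proj₁ parts (sym e)
      k₂≢i : k₂ ≢ i
      k₂≢i e = proj₂ (proj₂ parts) (sym e)
      pu = star-sub u su
      pw₁ = proj₁ (link→-parts k k₂ w₁ w₂ g)
      pw₂ = proj₂ (link→-parts k k₂ w₁ w₂ g)
      distinct : ∀ v → v ≢ w₁ → 0 < [ link→ i k u v ] → Unique (w₁ ∷ w₂ ∷ x ∷ u ∷ v ∷ [])
      distinct v v≢w₁ uv =
          (part-≢ P pw₁ pw₂ (proj₁ (proj₂ parts)) ∷ part-≢ P pw₁ px k≢i ∷ part-≢ P pw₁ pu k≢i ∷ (λ e → v≢w₁ (sym e)) ∷ [])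
        ∷ (part-≢ P pw₂ px k₂≢i ∷ part-≢ P pw₂ pu k₂≢i ∷ part-≢ P pw₂ pv (λ e → proj₁ (proj₂ parts) (sym e)) ∷ [])
        ∷ (proj₁ x-off ∷ proj₂ (proj₂ x-off) ∷ [])
        ∷ (proj₁ (proj₂ x-off) ∷ [])
        ∷ [] ∷ []
        where
        xuv = proj₁ (∧-elim ([]-true _ uv))
        pv = proj₂ (link→-parts i k u v ([]-true _ uv))
        x-off = nondeg H x u v xuv

    star-free : count3 (λ a b c → edge H a b c ∧ meet1 star a b c ∧ restIn star (link→ k k₂) a b c) ≡ 0
    star-free = count3-none _ λ a b c e →
      let (abc , rest) = ∧-elim {edge H a b c} e
          (once , in-G) = ∧-elim {meet1 star a b c} rest
          (u , w₁ , w₂ , su , g , uw₁w₂) = split-off H star (link→ k k₂) a b c abc once in-G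
      in star-F5 u w₁ w₂ su g uw₁w₂

  link-in-part-bound : ∀ {n} (H : ThreeGraph n) → F5-free H → (P : Partition n) (x : Fin n) →
    ∀ {i j l} → Distinct3 i j l → j ≢ P x → 129 ≤ size (U P i) → 0 < size (U P j) → ∀ k →
    (∀ M → Matching P l M → count2 M ≡ suc k →
       size (U P i) * size (U P j) * count2 M ≤ 2 ^ 7 *
         (Σ[] λ a → Σ[] λ b → count2 λ c d → U P i a ∧ U P j b ∧ M c d ∧ edge H a b c ∧ edge H a b d)) →
    Lsize H P x l l ≤ k * (n + n)
  link-in-part-bound {n} H free P x {i} {j} {l} parts j≢x big Uj>0 k dense
    with Greedy.greedy P l k (Link.link→ H P x l l) graph
    where
    graph : Greedy.Graph P l (Link.link→ H P x l l)
    graph = (λ u v → cong₂ _∧_ (sym₂₃ H x u v) (∧-comm (P u == l) (P v == l))) ,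
            (λ u → cong (_∧ _) (Link.edge-x-irrefl H P x u)) ,
            (λ u v e → proj₁ (Link.link→-parts H P x l l u v e))
  ... | inj₁ (M , matching , M⊆ , |M|) =
    ⊥-elim (DenseMatching.matching-F5 H free P x parts j≢x M matching (λ c d e → proj₁ (∧-elim (M⊆ c d e)))
              big (subst (λ m → 0 < size (U P j) * m) (sym |M|) (*-mono-≤ Uj>0 (s≤s z≤n)))
              (dense M matching |M|))
  ... | inj₂ bound = ≤-trans (≤-reflexive (ΣΣ-cong (λ u v →
                       cong (λ t → [ (u <ᵇ v) ∧ (edge H x u v ∧ t) ]) (∨-idem (P u == l ∧ P v == l))))) bound

module NatRational where
  open import Data.Nat as ℕ using (ℕ; zero; suc)
  import Data.Nat.Properties as ℕP
  open import Data.Integer as ℤ using (+_; +[1+_]; -[1+_])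
  import Data.Integer.Properties as ℤP
  open import Data.Rational as ℚ using (ℚ; mkℚ; toℚᵘ; 0ℚ; 1ℚ)
  import Data.Rational.Properties as ℚP
  open import Data.Rational.Unnormalised as ℚᵘ using (mkℚᵘ; *≡*; *≤*; *<*)
  import Data.Rational.Unnormalised.Properties as ℚᵘP
  import Data.Nat.Coprimality as Coprime
  open import Data.Product using (_×_; _,_; ∃-syntax)
  open import Data.Sum using (inj₁; inj₂)
  open import Data.Empty using (⊥-elim)
  open import Relation.Nullary using (Dec; yes; no)
  open import Relation.Binary.PropositionalEquality
  open import Algebra.Properties.Group ℚP.+-0-group using (⁻¹-involutive)

  toℚᵘ-ℕ : ∀ k → toℚᵘ (ℕ→ℚ k) ≡ mkℚᵘ (+ k) 0
  toℚᵘ-ℕ k = cong toℚᵘ (ℚP.normalize-coprime (Coprime.sym (Coprime.1-coprimeTo k)))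

  ℕ→ℚ-+ : ∀ a b → ℕ→ℚ (a ℕ.+ b) ≡ ℕ→ℚ a ℚ.+ ℕ→ℚ b
  ℕ→ℚ-+ a b = ℚP.toℚᵘ-injective (ℚᵘP.≃-trans (ℚᵘP.≃-reflexive (toℚᵘ-ℕ (a ℕ.+ b)))
    (ℚᵘP.≃-trans unnormalised (ℚᵘP.≃-sym (ℚᵘP.≃-trans (ℚP.toℚᵘ-homo-+ (ℕ→ℚ a) (ℕ→ℚ b))
                                                      (ℚᵘP.≃-reflexive (cong₂ ℚᵘ._+_ (toℚᵘ-ℕ a) (toℚᵘ-ℕ b)))))))
    where
    unnormalised : mkℚᵘ (+ (a ℕ.+ b)) 0 ℚᵘ.≃ (mkℚᵘ (+ a) 0 ℚᵘ.+ mkℚᵘ (+ b) 0)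
    unnormalised = *≡* (trans (ℤP.*-identityʳ (+ (a ℕ.+ b))) (sym (trans (ℤP.*-identityʳ _)
                     (trans (cong₂ ℤ._+_ (ℤP.*-identityʳ (+ a)) (ℤP.*-identityʳ (+ b))) (sym (ℤP.pos-+ a b))))))

  ℕ→ℚ-* : ∀ a b → ℕ→ℚ (a ℕ.* b) ≡ ℕ→ℚ a ℚ.* ℕ→ℚ b
  ℕ→ℚ-* a b = ℚP.toℚᵘ-injective (ℚᵘP.≃-trans (ℚᵘP.≃-reflexive (toℚᵘ-ℕ (a ℕ.* b)))
    (ℚᵘP.≃-trans unnormalised (ℚᵘP.≃-sym (ℚᵘP.≃-trans (ℚP.toℚᵘ-homo-* (ℕ→ℚ a) (ℕ→ℚ b))
                                                      (ℚᵘP.≃-reflexive (cong₂ ℚᵘ._*_ (toℚᵘ-ℕ a) (toℚᵘ-ℕ b)))))))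
    where
    unnormalised : mkℚᵘ (+ (a ℕ.* b)) 0 ℚᵘ.≃ (mkℚᵘ (+ a) 0 ℚᵘ.* mkℚᵘ (+ b) 0)
    unnormalised = *≡* (trans (ℤP.*-identityʳ (+ (a ℕ.* b))) (sym (trans (ℤP.*-identityʳ _) (sym (ℤP.pos-* a b)))))

  ℕ→ℚ-mono-≤ : ∀ {a b} → a ℕ.≤ b → ℕ→ℚ a ℚ.≤ ℕ→ℚ b
  ℕ→ℚ-mono-≤ {a} {b} a≤b = ℚP.toℚᵘ-cancel-≤ (subst₂ ℚᵘ._≤_ (sym (toℚᵘ-ℕ a)) (sym (toℚᵘ-ℕ b))
    (*≤* (subst₂ ℤ._≤_ (sym (ℤP.*-identityʳ (+ a))) (sym (ℤP.*-identityʳ (+ b))) (ℤ.+≤+ a≤b))))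

  ℕ→ℚ-mono-< : ∀ {a b} → a ℕ.< b → ℕ→ℚ a ℚ.< ℕ→ℚ b
  ℕ→ℚ-mono-< {a} {b} a<b = ℚP.toℚᵘ-cancel-< (subst₂ ℚᵘ._<_ (sym (toℚᵘ-ℕ a)) (sym (toℚᵘ-ℕ b))
    (*<* (subst₂ ℤ._<_ (sym (ℤP.*-identityʳ (+ a))) (sym (ℤP.*-identityʳ (+ b))) (ℤ.+<+ a<b))))

  ℕ→ℚ-cancel-< : ∀ {a b} → ℕ→ℚ a ℚ.< ℕ→ℚ b → a ℕ.< b
  ℕ→ℚ-cancel-< {a} {b} a<b with subst₂ ℚᵘ._<_ (toℚᵘ-ℕ a) (toℚᵘ-ℕ b) (ℚP.toℚᵘ-mono-< a<b)
  ... | *<* q = ℤP.drop‿+<+ (subst₂ ℤ._<_ (ℤP.*-identityʳ (+ a)) (ℤP.*-identityʳ (+ b)) q)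

  ℕ→ℚ-nonneg : ∀ k → 0ℚ ℚ.≤ ℕ→ℚ k
  ℕ→ℚ-nonneg k = ℕ→ℚ-mono-≤ {0} {k} ℕ.z≤n

  archimedean : ∀ μ → 0ℚ ℚ.< μ → ∃[ N ] (1ℚ ℚ.≤ μ ℚ.* ℕ→ℚ N)
  archimedean μ@(mkℚ +[1+ p ] q-1 _) _ = suc q-1 ,
    ℚP.toℚᵘ-cancel-≤ (ℚᵘP.≤-respʳ-≃ (ℚᵘP.≃-sym (ℚᵘP.≃-trans (ℚP.toℚᵘ-homo-* μ (ℕ→ℚ (suc q-1)))
                                                           (ℚᵘP.≃-reflexive (cong (toℚᵘ μ ℚᵘ.*_) (toℚᵘ-ℕ (suc q-1))))))
                                     (*≤* cross-multiplied))
    where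
    cross-multiplied : + 1 ℤ.* + (suc q-1 ℕ.* 1) ℤ.≤ (+ suc p ℤ.* + suc q-1) ℤ.* + 1
    cross-multiplied = subst₂ ℤ._≤_ (ℤP.pos-* 1 (suc q-1 ℕ.* 1))
      (trans (ℤP.pos-* (suc p ℕ.* suc q-1) 1) (cong (ℤ._* + 1) (ℤP.pos-* (suc p) (suc q-1))))
      (ℤ.+≤+ (subst₂ ℕ._≤_ (sym (trans (ℕP.*-identityˡ _) (ℕP.*-identityʳ _))) (sym (ℕP.*-identityʳ _))
                          (ℕP.m≤n*m (suc q-1) (suc p))))
  archimedean (mkℚ (+ 0) _ _) (ℚ.*<* 0<0) = ⊥-elim (ℤP.<-irrefl refl 0<0)
  archimedean (mkℚ -[1+ _ ] _ _) (ℚ.*<* ())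

  abs< : ∀ x y → ℚ.∣ x ∣ ℚ.< y → (ℚ.- y ℚ.< x) × (x ℚ.< y)
  abs< x y h with ℚP.∣p∣≡p∨∣p∣≡-p x
  ... | inj₁ e = ℚP.<-≤-trans (ℚP.neg-antimono-< (ℚP.≤-<-trans (ℚP.0≤∣p∣ x) h)) (subst (0ℚ ℚ.≤_) e (ℚP.0≤∣p∣ x)) ,
                 subst (ℚ._< y) e h
  ... | inj₂ e = subst (ℚ.- y ℚ.<_) (⁻¹-involutive x) (ℚP.neg-antimono-< (subst (ℚ._< y) e h)) ,
                 ℚP.≤-<-trans (ℚP.≤-trans x≤0 (ℚP.0≤∣p∣ x)) h
    where
    x≤0 : x ℚ.≤ 0ℚ
    x≤0 = subst (ℚ._≤ 0ℚ) (⁻¹-involutive x) (ℚP.neg-antimono-≤ (subst (0ℚ ℚ.≤_) e (ℚP.0≤∣p∣ x)))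

  floor-search : ∀ B (r : ℚ) → 0ℚ ℚ.< r → r ℚ.≤ ℕ→ℚ B → ∃[ k ] (ℕ→ℚ k ℚ.< r × r ℚ.≤ ℕ→ℚ (suc k))
  floor-search zero    r r>0 r≤0 = ⊥-elim (ℚP.<-irrefl refl (ℚP.<-≤-trans r>0 r≤0))
  floor-search (suc B) r r>0 r≤B+1 = step (r ℚP.≤? ℕ→ℚ B)
    where
    step : Dec (r ℚ.≤ ℕ→ℚ B) → ∃[ k ] (ℕ→ℚ k ℚ.< r × r ℚ.≤ ℕ→ℚ (suc k))
    step (yes r≤B) = floor-search B r r>0 r≤B
    step (no  r≰B) = B , ℚP.≰⇒> r≰B , r≤B+1

module Bounds {n : ℕ} (μ : ℚ) (μ>0 : 0ℚ ℚ.< μ) (N₁ : ℕ) (μN₁≥1 : 1ℚ ℚ.≤ μ ℚ.* ℕ→ℚ N₁) (n-large : 774 ℕ.+ N₁ ℕ.≤ n)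
              (H : ThreeGraph n) (free : F5-free H) (P : Partition n) (opt : Optimal H P) (dense : LowerDense H P μ)
              (x : Fin n) (px : P x ≡ zero) where
  open Combinatorics
  open NatRational
  open import Data.Nat using (_+_; _*_; _^_; z≤n; s≤s)
  import Data.Nat.Properties as ℕP
  open import Data.Integer using (+_)
  import Data.Rational.Properties as ℚP
  open import Data.Product using (_,_; proj₁; proj₂)
  open import Data.Empty using (⊥)
  open import Relation.Nullary using (Dec; yes; no)
  open import Relation.Nullary.Decidable using (toWitness)
  open import Relation.Binary.PropositionalEquality using (refl; sym; trans; cong; subst; subst₂)
  open import Data.Rational.Solver using (module +-*-Solver)
  open +-*-Solver

  ⅓ ¼ ⅙ : ℚ
  ⅓ = + 1 ℚ./ 3
  ¼ = + 1 ℚ./ 4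
  ⅙ = + 1 ℚ./ 6

  N : ℚ
  N = ℕ→ℚ n

  B : ℚ
  B = ℕ→ℚ 2 ℚ.* μ ℚ.* N ℚ.* N

  s : Fin 3 → ℚ
  s i = ℕ→ℚ (size (U P i))

  ld-ii : LD-ii H P μ
  ld-ii = proj₁ (proj₂ dense)

  ld-iii : LD-iii H P μ
  ld-iii = proj₁ (proj₂ (proj₂ dense))

  ld-iv : LD-iv P μ
  ld-iv = proj₂ (proj₂ (proj₂ dense))

  N>0 : 0ℚ ℚ.< N
  N>0 = ℕ→ℚ-mono-< {0} {n} (ℕP.<-≤-trans (s≤s z≤n) (ℕP.≤-trans (ℕP.m≤m+n 774 N₁) n-large))

  N≥0 : 0ℚ ℚ.≤ N
  N≥0 = ℕ→ℚ-nonneg n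

  μ≥0 : 0ℚ ℚ.≤ μ
  μ≥0 = ℚP.<⇒≤ μ>0

  part-above : ∀ i → N ℚ.* ⅓ ℚ.- μ ℚ.* N ℚ.< s i
  part-above i = subst₂ ℚ._<_ (solve 2 (λ y c → (:- y) :+ c := c :- y) refl (μ ℚ.* N) (N ℚ.* ⅓))
                              (solve 2 (λ a c → (a :- c) :+ c := a) refl (s i) (N ℚ.* ⅓))
                              (ℚP.+-monoˡ-< (N ℚ.* ⅓) (proj₁ (abs< _ _ (ld-iv i))))

  part-below : ∀ i → s i ℚ.< N ℚ.* ⅓ ℚ.+ μ ℚ.* N
  part-below i = subst₂ ℚ._<_ (solve 2 (λ a c → (a :- c) :+ c := a) refl (s i) (N ℚ.* ⅓))
                              (solve 2 (λ y c → y :+ c := c :+ y) refl (μ ℚ.* N) (N ℚ.* ⅓))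
                              (ℚP.+-monoˡ-< (N ℚ.* ⅓) (proj₂ (abs< _ _ (ld-iv i))))

  large-μ : ∀ i j → ¼ ℚ.< μ → ℕ→ℚ (Lsize H P x i j) ℚ.< B
  large-μ i j ¼<μ = ℚP.≰⇒> λ B≤L → ℚP.<-irrefl refl (ℚP.≤-<-trans (ℚP.+-mono-≤ B≤L B≤L) (ℚP.≤-<-trans 2L≤N² N²<2B))
    where
    L = ℕ→ℚ (Lsize H P x i j)
    2L≤N² : L ℚ.+ L ℚ.≤ N ℚ.* N
    2L≤N² = subst₂ ℚ._≤_ (ℕ→ℚ-+ (Lsize H P x i j) _) (ℕ→ℚ-* n n) (ℕ→ℚ-mono-≤ (Link.Lsize≤square H P x i j))
    N²<2B : N ℚ.* N ℚ.< B ℚ.+ B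
    N²<2B = subst₂ ℚ._<_ (solve 1 (λ a → con 1ℚ :* a := a) refl (N ℚ.* N))
              (solve 2 (λ m N → con (ℕ→ℚ 4) :* m :* (N :* N) := (con (ℕ→ℚ 2) :* m :* N :* N) :+ (con (ℕ→ℚ 2) :* m :* N :* N)) refl μ N)
              (ℚP.*-monoˡ-<-pos (N ℚ.* N) {{ℚP.pos*pos⇒pos N {{ℚ.positive N>0}} N {{ℚ.positive N>0}}}}
                 (ℚP.*-monoʳ-<-pos (ℕ→ℚ 4) {{ℚ.positive (ℕ→ℚ-mono-< {0} {4} (s≤s z≤n))}} ¼<μ))

  -- For 1/6 ≤ μ ≤ 1/4, |L_{i,j}(x)| ≤ |U_i||U_j| < (1/3 + μ)² n² ≤ 2μn².
  middle-square : ⅙ ℚ.≤ μ → μ ℚ.≤ ¼ → (⅓ ℚ.+ μ) ℚ.* (⅓ ℚ.+ μ) ℚ.≤ ℕ→ℚ 2 ℚ.* μ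
  middle-square ⅙≤μ μ≤¼ = ℚP.≤-trans (ℚP.*-monoʳ-≤-nonNeg a {{ℚ.nonNegative a≥0}} a≤7/12)
    (subst (ℚ._≤ ℕ→ℚ 2 ℚ.* μ) (solve 1 (λ m → con (+ 7 ℚ./ 36) :+ con (+ 7 ℚ./ 12) :* m := con (+ 7 ℚ./ 12) :* (con ⅓ :+ m)) refl μ)
      (subst (+ 7 ℚ./ 36 ℚ.+ + 7 ℚ./ 12 ℚ.* μ ℚ.≤_) (solve 1 (λ m → con (+ 17 ℚ./ 12) :* m :+ con (+ 7 ℚ./ 12) :* m := con (ℕ→ℚ 2) :* m) refl μ)
        (ℚP.+-monoˡ-≤ (+ 7 ℚ./ 12 ℚ.* μ) 7/36≤17μ/12)))
    where
    a = ⅓ ℚ.+ μ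
    a≥0 : 0ℚ ℚ.≤ a
    a≥0 = ℚP.≤-trans (toWitness {a? = 0ℚ ℚP.≤? ⅓} _) (subst (ℚ._≤ a) (solve 1 (λ z → z :+ con 0ℚ := z) refl ⅓) (ℚP.+-monoʳ-≤ ⅓ μ≥0))
    a≤7/12 : a ℚ.≤ + 7 ℚ./ 12
    a≤7/12 = ℚP.≤-trans (ℚP.+-monoʳ-≤ ⅓ μ≤¼) (toWitness {a? = (⅓ ℚ.+ ¼) ℚP.≤? (+ 7 ℚ./ 12)} _)
    7/36≤17μ/12 : + 7 ℚ./ 36 ℚ.≤ + 17 ℚ./ 12 ℚ.* μ
    7/36≤17μ/12 = ℚP.≤-trans (toWitness {a? = (+ 7 ℚ./ 36) ℚP.≤? (+ 17 ℚ./ 12 ℚ.* ⅙)} _)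
                             (ℚP.*-monoˡ-≤-nonNeg (+ 17 ℚ./ 12) {{ℚ.nonNegative (toWitness {a? = 0ℚ ℚP.≤? (+ 17 ℚ./ 12)} _)}} ⅙≤μ)

  middle-μ : ∀ i j → ⅙ ℚ.≤ μ → μ ℚ.≤ ¼ → ℕ→ℚ (Lsize H P x i j) ℚ.< B
  middle-μ i j ⅙≤μ μ≤¼ = begin-strict
    ℕ→ℚ (Lsize H P x i j)
      ≤⟨ subst (ℕ→ℚ (Lsize H P x i j) ℚ.≤_) (ℕ→ℚ-* (size (U P i)) (size (U P j))) (ℕ→ℚ-mono-≤ (Link.Lsize≤product H P x i j)) ⟩
    s i ℚ.* s j
      ≤⟨ ℚP.*-monoˡ-≤-nonNeg (s i) {{ℚ.nonNegative (ℕ→ℚ-nonneg (size (U P i)))}} (ℚP.<⇒≤ (part-below j)) ⟩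
    s i ℚ.* M
      <⟨ ℚP.*-monoˡ-<-pos M {{ℚ.positive M>0}} (part-below i) ⟩
    M ℚ.* M
      ≡⟨ solve 2 (λ m N → (N :* con ⅓ :+ m :* N) :* (N :* con ⅓ :+ m :* N) := (con ⅓ :+ m) :* (con ⅓ :+ m) :* (N :* N)) refl μ N ⟩
    (⅓ ℚ.+ μ) ℚ.* (⅓ ℚ.+ μ) ℚ.* (N ℚ.* N)
      ≤⟨ ℚP.*-monoʳ-≤-nonNeg (N ℚ.* N) {{ℚP.nonNeg*nonNeg⇒nonNeg N {{ℚ.nonNegative N≥0}} N {{ℚ.nonNegative N≥0}}}} (middle-square ⅙≤μ μ≤¼) ⟩
    ℕ→ℚ 2 ℚ.* μ ℚ.* (N ℚ.* N)
      ≡⟨ solve 2 (λ m N → con (ℕ→ℚ 2) :* m :* (N :* N) := con (ℕ→ℚ 2) :* m :* N :* N) refl μ N ⟩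
    B ∎
    where
    open ℚP.≤-Reasoning
    M = N ℚ.* ⅓ ℚ.+ μ ℚ.* N
    M>0 : 0ℚ ℚ.< M
    M>0 = ℚP.≤-<-trans (ℕ→ℚ-nonneg (size (U P i))) (part-below i)

  -- For μ ≤ 1/6 every part has more than n/6 ≥ μn vertices, so lower density applies.
  module Small (μ≤⅙ : μ ℚ.≤ ⅙) where

    μN≤N/6 : μ ℚ.* N ℚ.≤ ⅙ ℚ.* N
    μN≤N/6 = ℚP.*-monoʳ-≤-nonNeg N {{ℚ.nonNegative N≥0}} μ≤⅙

    part>N/6 : ∀ i → ⅙ ℚ.* N ℚ.< s i
    part>N/6 i = ℚP.≤-<-trans (subst (ℚ._≤ N ℚ.* ⅓ ℚ.- μ ℚ.* N) (solve 1 (λ N → N :* con ⅓ :- con ⅙ :* N := con ⅙ :* N) refl N)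
                                     (ℚP.+-monoʳ-≤ (N ℚ.* ⅓) (ℚP.neg-antimono-≤ μN≤N/6)))
                              (part-above i)

    part≥μN : ∀ i → μ ℚ.* N ℚ.≤ s i
    part≥μN i = ℚP.≤-trans μN≤N/6 (ℚP.<⇒≤ (part>N/6 i))

    -- as n ≥ 774 > 6 · 128
    part≥129 : ∀ i → 129 ℕ.≤ size (U P i)
    part≥129 i = ℕP.≮⇒≥ λ small → ℕP.<-asym n<6|U| (ℕP.≤-<-trans (ℕP.*-monoʳ-≤ 6 (ℕP.≤-pred small)) 768<n)
      where
      768<n : 768 ℕ.< n
      768<n = ℕP.≤-trans (ℕP.m≤m+n 769 (5 + N₁)) n-large
      n<6|U| : n ℕ.< 6 * size (U P i)
      n<6|U| = ℕ→ℚ-cancel-< (subst₂ ℚ._<_ (solve 1 (λ N → con (ℕ→ℚ 6) :* (con ⅙ :* N) := N) refl N) (sym (ℕ→ℚ-* 6 (size (U P i))))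
                 (ℚP.*-monoʳ-<-pos (ℕ→ℚ 6) {{ℚ.positive (ℕ→ℚ-mono-< {0} {6} (s≤s z≤n))}} (part>N/6 i)))

    -- μn ≥ μN₁ ≥ 1
    μN≥1 : 1ℚ ℚ.≤ μ ℚ.* N
    μN≥1 = ℚP.≤-trans μN₁≥1 (ℚP.*-monoˡ-≤-nonNeg μ {{ℚ.nonNegative μ≥0}} (ℕ→ℚ-mono-≤ (ℕP.≤-trans (ℕP.m≤n+m N₁ 774) n-large)))

    -- |L_{l,l}(x)| < 2μn² where U_l is one of three distinct parts U_i, U_j, U_l with x ∉ U_j:
    -- a link matching of ⌈μn⌉ pairs in U_l would contradict condition (iii), so the greedy
    -- matching stops after k < μn rounds, each removing fewer than 2n pairs.
    in-part : ∀ {i j l} → Distinct3 i j l → j ≢ zero → ℕ→ℚ (Lsize H P x l l) ℚ.< B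
    in-part {i} {j} {l} parts j≢0 =
      let (k , k<μN , μN≤k+1) = floor-search n (μ ℚ.* N) μN>0 μN≤N
      in begin-strict
      ℕ→ℚ (Lsize H P x l l)
        ≤⟨ subst (ℕ→ℚ (Lsize H P x l l) ℚ.≤_) (trans (ℕ→ℚ-* k (n + n)) (cong (ℕ→ℚ k ℚ.*_) (ℕ→ℚ-+ n n)))
                 (ℕ→ℚ-mono-≤ (L≤2kn k μN≤k+1)) ⟩
      ℕ→ℚ k ℚ.* (N ℚ.+ N)
        <⟨ ℚP.*-monoˡ-<-pos (N ℚ.+ N) {{ℚ.positive (ℚP.+-mono-< N>0 N>0)}} k<μN ⟩
      μ ℚ.* N ℚ.* (N ℚ.+ N)
        ≡⟨ solve 2 (λ m N → m :* N :* (N :+ N) := con (ℕ→ℚ 2) :* m :* N :* N) refl μ N ⟩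
      B ∎
      where
      open ℚP.≤-Reasoning
      μN>0 : 0ℚ ℚ.< μ ℚ.* N
      μN>0 = ℚP.<-≤-trans (toWitness {a? = 0ℚ ℚP.<? 1ℚ} _) μN≥1
      μN≤N : μ ℚ.* N ℚ.≤ N
      μN≤N = ℚP.≤-trans μN≤N/6 (subst (⅙ ℚ.* N ℚ.≤_) (solve 1 (λ N → con 1ℚ :* N := N) refl N)
               (ℚP.*-monoʳ-≤-nonNeg N {{ℚ.nonNegative N≥0}} (toWitness {a? = ⅙ ℚP.≤? 1ℚ} _)))
      L≤2kn : ∀ k → μ ℚ.* N ℚ.≤ ℕ→ℚ (ℕ.suc k) → Lsize H P x l l ℕ.≤ k * (n + n)
      L≤2kn k μN≤k+1 = link-in-part-bound H free P x parts (λ e → j≢0 (trans e px)) (part≥129 i) (ℕP.≤-trans (s≤s z≤n) (part≥129 j)) k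
        λ M matching |M| → ld-iii i j l parts (U P i) (U P j) M (U-sub P i) (U-sub P j) matching
                             (part≥μN i) (part≥μN j) (subst (λ m → μ ℚ.* N ℚ.≤ ℕ→ℚ m) (sym |M|) μN≤k+1)

    -- |L_{1,k}(x)| < 2μn² when |L_{1,k}(x)| ≤ |L_{k,k₂}(x)| (as optimality guarantees):
    -- otherwise the star set S of Star has at least μn vertices and L_{k,k₂}(x) has
    -- at least μ²n² pairs, and condition (ii) gives an edge through both, which F₅-freeness forbids.
    across : ∀ {k k₂} → Distinct3 zero k k₂ → Lsize H P x zero k ℕ.≤ Lsize H P x k k₂ →
             ℕ→ℚ (Lsize H P x zero k) ℚ.< B
    across {k} {k₂} parts L≤L′ = ℚP.≰⇒> not-large
      where
      open Star H free P x parts px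
      L = Lsize H P x zero k
      G = Link.link→ H P x k k₂

      not-large : B ℚ.≤ ℕ→ℚ L → ⊥
      not-large B≤L = ℕP.n≮0 (subst (size star * ΣΣ (λ u v → [ G u v ]) ℕ.<_) (cong (2 ^ 3 *_) star-free)
                        (ld-ii zero k k₂ parts star G star-sub (Link.link→-parts H P x k k₂) star-large G-large))
        where
        open ℚP.≤-Reasoning
        -- if |S| < μn then |L| ≤ |S|n + n < μn² + n ≤ 2μn²
        star-large : μ ℚ.* N ℚ.≤ ℕ→ℚ (size star)
        star-large = ℚP.≮⇒≥ λ S<μN → ℚP.<-irrefl refl (begin-strict
          B                                   ≤⟨ B≤L ⟩
          ℕ→ℚ L                               ≤⟨ subst (ℕ→ℚ L ℚ.≤_) (trans (ℕ→ℚ-+ (size star * n) n) (cong (ℚ._+ N) (ℕ→ℚ-* (size star) n)))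
                                                       (ℕ→ℚ-mono-≤ star-bound) ⟩
          ℕ→ℚ (size star) ℚ.* N ℚ.+ N         <⟨ ℚP.+-monoˡ-< N (ℚP.*-monoˡ-<-pos N {{ℚ.positive N>0}} S<μN) ⟩
          μ ℚ.* N ℚ.* N ℚ.+ N                 ≤⟨ ℚP.+-monoʳ-≤ (μ ℚ.* N ℚ.* N) (subst (ℚ._≤ μ ℚ.* N ℚ.* N) (solve 1 (λ N → con 1ℚ :* N := N) refl N)
                                                   (ℚP.*-monoʳ-≤-nonNeg N {{ℚ.nonNegative N≥0}} μN≥1)) ⟩
          μ ℚ.* N ℚ.* N ℚ.+ μ ℚ.* N ℚ.* N     ≡⟨ solve 2 (λ m N → m :* N :* N :+ m :* N :* N := con (ℕ→ℚ 2) :* m :* N :* N) refl μ N ⟩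
          B                                   ∎)
        -- μ²n² ≤ 2μn² ≤ |L_{1,k}(x)| ≤ |L_{k,k₂}(x)|
        G-large : μ ℚ.* μ ℚ.* N ℚ.* N ℚ.≤ ℕ→ℚ (ΣΣ (λ u v → [ G u v ]))
        G-large = begin
          μ ℚ.* μ ℚ.* N ℚ.* N   ≤⟨ ℚP.*-monoʳ-≤-nonNeg N {{ℚ.nonNegative N≥0}} (ℚP.*-monoʳ-≤-nonNeg N {{ℚ.nonNegative N≥0}}
                                     (ℚP.*-monoʳ-≤-nonNeg μ {{ℚ.nonNegative μ≥0}} (ℚP.≤-trans μ≤⅙ (toWitness {a? = ⅙ ℚP.≤? ℕ→ℚ 2} _)))) ⟩
          B                     ≤⟨ B≤L ⟩
          ℕ→ℚ L                 ≤⟨ ℕ→ℚ-mono-≤ (ℕP.≤-trans L≤L′ (ℕP.≤-reflexive (Link.Lsize-ordered H P x k k₂ (proj₁ (proj₂ parts))))) ⟩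
          ℕ→ℚ (ΣΣ (λ u v → [ G u v ])) ∎

  by-range : ∀ i j → (μ ℚ.≤ ⅙ → ℕ→ℚ (Lsize H P x i j) ℚ.< B) → ℕ→ℚ (Lsize H P x i j) ℚ.< B
  by-range i j small = range (μ ℚP.≤? ⅙) (μ ℚP.≤? ¼)
    where
    range : Dec (μ ℚ.≤ ⅙) → Dec (μ ℚ.≤ ¼) → ℕ→ℚ (Lsize H P x i j) ℚ.< B
    range (yes μ≤⅙) _          = small μ≤⅙
    range (no μ≰⅙)  (yes μ≤¼)  = middle-μ i j (ℚP.<⇒≤ (ℚP.≰⇒> μ≰⅙)) μ≤¼
    range (no _)    (no μ≰¼)   = large-μ i j (ℚP.≰⇒> μ≰¼)

open import Data.Nat using (_≤_)
open import Data.Rational using (_<_; _*_)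
open import Data.Product using (_×_; _,_; ∃-syntax)
open import Relation.Binary.PropositionalEquality using (subst)
open Combinatorics using (module Link; module Move)
open NatRational using (archimedean)

lemma7 : (η μ : ℚ) → 0ℚ < η → 0ℚ < μ →
    ∃[ n₀ ] ((n : ℕ) → n₀ ≤ n →
      (H : ThreeGraph n) → InForb H η μ →
      (P : Partition n) → Optimal H P → LowerDense H P μ →
      (x : Fin n) → P x ≡ zero →
        (ℕ→ℚ (Lsize H P x zero zero) < ℕ→ℚ 2 * μ * ℕ→ℚ n * ℕ→ℚ n) ×
        (ℕ→ℚ (Lsize H P x zero (suc zero)) < ℕ→ℚ 2 * μ * ℕ→ℚ n * ℕ→ℚ n) ×
        (ℕ→ℚ (Lsize H P x (suc zero) (suc zero)) < ℕ→ℚ 2 * μ * ℕ→ℚ n * ℕ→ℚ n) ×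
        (ℕ→ℚ (Lsize H P x zero (suc (suc zero))) < ℕ→ℚ 2 * μ * ℕ→ℚ n * ℕ→ℚ n) ×
        (ℕ→ℚ (Lsize H P x (suc (suc zero)) (suc (suc zero))) < ℕ→ℚ 2 * μ * ℕ→ℚ n * ℕ→ℚ n))
lemma7 η μ _ μ>0 =
  let (N₁ , μN₁≥1) = archimedean μ μ>0 in
  774 ℕ.+ N₁ , λ n n-large H (free , _ , _) P opt dense x px →
    let open Bounds μ μ>0 N₁ μN₁≥1 n-large H free P opt dense x px
        (L₁₂≤L₂₃ , L₁₃≤L₂₃) = Move.optimal-link H P x opt px
    in by-range zero zero (λ small → Small.in-part small {suc zero} {suc (suc zero)} ((λ ()) , (λ ()) , (λ ())) (λ ()))
     , by-range zero (suc zero) (λ small → Small.across small ((λ ()) , (λ ()) , (λ ())) L₁₂≤L₂₃)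
     , by-range (suc zero) (suc zero) (λ small → Small.in-part small {zero} {suc (suc zero)} ((λ ()) , (λ ()) , (λ ())) (λ ()))
     , by-range zero (suc (suc zero)) (λ small → Small.across small ((λ ()) , (λ ()) , (λ ()))
         (subst (Lsize H P x zero (suc (suc zero)) ≤_) (Link.Lsize-comm H P x (suc zero) (suc (suc zero))) L₁₃≤L₂₃))
     , by-range (suc (suc zero)) (suc (suc zero)) (λ small → Small.in-part small {zero} {suc zero} ((λ ()) , (λ ()) , (λ ())) (λ ()))
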